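{- Let $G=\bigoplus_{t=1}^r\mathbb{Z}_{k_t}$ (each $k_t\ge2$, $|G|=\prod_tk_t$) and let $\mathrm{Seq}(G;D)$ be a class of locally restricted compositions over $G$ with span $\sigma$ associated with a digraph $D$ (as in the context), satisfying: 1. the gcd of the lengths of all directed cycles in $D_{\mathcal R}$ is $1$; 2. for each $1\le t\le r$ there exist $\ell\ge1$, recurrent vertices ${\bf u},{\bf v}$ and a nonempty set $\mathcal W_{\mathcal R}$ of directed walks in $D_{\mathcal R}$ of length $\ell$ from ${\bf u}$ to ${\bf v}$ such that (a) for every walk ${\bf u}{\bf u}_1\cdots{\bf u}_{\ell-1}{\bf v}\in\mathcal W_{\mathcal R}$, every $1\le j\le\ell-1$ and every $i\neq t$, the $i$-th coordinate $u_{i,j}$ of $|{\bf u}_j|$ equals a number $\phi_{i,j}$ that is the same for all walks in $\mathcal W_{\mathcal R}$, and (b) $\gcd\{m-n:m,n\in N\}=1$ where $N=\{u_{t,1}+\cdots+u_{t,\ell-1}: {\bf u}{\bf u}_1\cdots{\bf u}_{\ell-1}{\bf v}\in\mathcal W_{\mathcal R}\}$. Let $m=a\sigma+b$ with $a\ge1$, $0\le b<\sigma$, $b$ fixed, and suppose there is at least one arc from $\mathcal R$ to $\mathrm{Seq}_b(G)$. Let $H$ be the outdegree of $\varepsilon_s$, and suppose there are constants $J,K$ such that every recurrent vertex has outdegree $K$ in $D_{\mathcal R}$ and every recurrent vertex is joined by arcs to exactly $J$ vertices in $\mathrm{Seq}_b(G)$. Then, with $c_m({\bf s},D)$ the number of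 $m$-compositions of ${\bf s}\in G$ in $\mathrm{Seq}(G;D)$, there is $0<\theta<1$ such that $$c_m({\bf s},D)=A\,B^m\big(1+O(\theta^m)\big),\quad m=a\sigma+b\to\infty,\qquad A=\frac{HJ}{|G|\,K^{1+b/\sigma}},\quad B=K^{1/\sigma}.$$
   Context: Elements of $G$ are integer tuples with $0\le x_t\le k_t-1$, added componentwise modulo $k_t$. $\mathrm{Seq}_m(G)=G^m$; the size $|({\bf x}_1,\ldots,{\bf x}_m)|$ is the componentwise ordinary integer sum of the parts. Locally restricted compositions: for $\sigma\ge1$, let $\varepsilon_s$ be a distinguished copy of the empty composition, $\mathcal T=\mathrm{Seq}_0(G)\cup\cdots\cup\mathrm{Seq}_{\sigma-1}(G)$, $\mathcal R$ a nonempty subset of $\mathrm{Seq}_\sigma(G)$ (the recurrent vertices), and $D$ a digraph on the disjoint union $\{\varepsilon_s\}\cup\mathcal R\cup\mathcal T$ such that there is at least one arc from $\varepsilon_s$ to $\mathcal R$ and at least one from $\mathcal R$ to $\mathcal T$, there are no arcs or loops among $\{\varepsilon_s\}\cup\mathcal T$, and the induced subdigraph $D_{\mathcal R}$ is strongly connected with at least two vertices. $\mathrm{Seq}(G;D)$ is the class of compositions obtained by concatenating the vertices of directed walks from $\varepsilon_s$ to $\mathcal T$. An $m$-composition of ${\bf s}$ in it is a member with $m$ parts summing to ${\bf s}$ in $G$. -}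

module Defs where

open import Data.Nat using (ℕ; zero; suc; _+_; _*_; _%_; _<_)
open import Data.Nat.DivMod using (m%n<n)
open import Data.Nat.Divisibility using (_∣_)
open import Data.Fin using (Fin; zero; suc; toℕ; fromℕ<)
open import Data.Vec using (Vec; []; _∷_; head; last; _∷ʳ_; concat; toList; lookup)
open import Data.Vec.Relation.Unary.All using (All; []; _∷_)
open import Data.List using (List; foldr; map; _++_; length)
open import Data.Nat.ListAction using (sum)
open import Data.Empty using (⊥)
open import Data.Integer as ℤ using (ℤ; +_)
open import Data.Integer.Divisibility as ℤD using ()
open import Function.Bundles using (_↔_)
open import Data.Bool using (Bool; T)
open import Data.Product using (Σ; ∃; ∃-syntax; _×_; _,_)
open import Data.Unit using (⊤)
open import Relation.Binary.PropositionalEquality using (_≡_)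

-- Moduli are given by  ks : Vec ℕ r
-- with  k_t = 2 + ks[t]  (this encodes the hypothesis k_t ≥ 2).

modulus : ℕ → ℕ
modulus k = suc (suc k)

G : ∀ {r} → Vec ℕ r → Set
G ks = All (λ k → Fin (modulus k)) ks

order : ∀ {r} → Vec ℕ r → ℕ
order [] = 1
order (k ∷ ks) = modulus k * order ks

addMod : ∀ {n} → Fin (suc n) → Fin (suc n) → Fin (suc n)
addMod {n} x y = fromℕ< (m%n<n (toℕ x + toℕ y) (suc n))

_⊕_ : ∀ {r} {ks : Vec ℕ r} → G ks → G ks → G ks
[] ⊕ [] = []
(x ∷ xs) ⊕ (y ∷ ys) = addMod x y ∷ (xs ⊕ ys)

0G : ∀ {r} {ks : Vec ℕ r} → G ks
0G {ks = []} = []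
0G {ks = k ∷ ks} = zero ∷ 0G

coord : ∀ {r} {ks : Vec ℕ r} → G ks → Fin r → ℕ
coord (x ∷ xs) zero = toℕ x
coord (x ∷ xs) (suc i) = coord xs i

sumG : ∀ {r} {ks : Vec ℕ r} → List (G ks) → G ks
sumG = foldr _⊕_ 0G

size : ∀ {r} {ks : Vec ℕ r} {n} → Vec (G ks) n → Fin r → ℕ
size xs i = sum (map (λ g → coord g i) (toList xs))

-- Vertices of D: ε_s, recurrent vertices (elements of Seq_σ(G) with isR),
-- and T = Seq_0(G) ∪ … ∪ Seq_{σ-1}(G), encoded as pairs (j : Fin σ , y : Vec G j).
-- Arcs of D: ε_s → x  (x recurrent, start x),  u → v (both recurrent, arcR u v),
-- u → (j , y) (u recurrent, arcT u j y).  No other arcs (ε_s is a source,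
-- T-vertices are sinks, no arcs among {ε_s} ∪ T).

record LRDigraph {r} (ks : Vec ℕ r) (σ : ℕ) : Set where
  field
    isR   : Vec (G ks) σ → Bool
    start : Vec (G ks) σ → Bool
    arcR  : Vec (G ks) σ → Vec (G ks) σ → Bool
    arcT  : Vec (G ks) σ → (j : Fin σ) → Vec (G ks) (toℕ j) → Bool

module _ {r} {ks : Vec ℕ r} {σ : ℕ} (D : LRDigraph ks σ) where
  open LRDigraph D

  V : Set
  V = Vec (G ks) σ

  Rec : V → Set
  Rec u = T (isR u)

  ArcS : V → Set
  ArcS x = Rec x × T (start x)

  ArcRR : V → V → Set
  ArcRR u v = Rec u × Rec v × T (arcR u v)

  ArcRT : V → (j : Fin σ) → Vec (G ks) (toℕ j) → Set
  ArcRT u j y = Rec u × T (arcT u j y)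

  Chain : ∀ {n} → Vec V n → Set
  Chain [] = ⊤
  Chain (x ∷ []) = Rec x
  Chain (x ∷ y ∷ xs) = ArcRR x y × Chain (y ∷ xs)

  WalkR : V → V → (n : ℕ) → Vec V (suc n) → Set
  WalkR u v n w = head w ≡ u × last w ≡ v × Chain w

  StronglyConnected : Set
  StronglyConnected = ∀ u v → Rec u → Rec v → ∃[ n ] Σ (Vec V (suc n)) (WalkR u v n)

  AtLeastTwoRec : Set
  AtLeastTwoRec = Σ V λ u → Σ V λ v → Rec u × Rec v × (u ≡ v → ⊥)

  IsCycle : ∀ {n} → Vec V (suc n) → Set
  IsCycle {n} vs = Chain (vs ∷ʳ head vs) × (∀ i j → lookup vs i ≡ lookup vs j → i ≡ j)

  record Walk : Set where
    field
      k  : ℕ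
      xs : Vec V (suc k)
      j  : Fin σ
      y  : Vec (G ks) (toℕ j)
      startArc : ArcS (head xs)
      chain    : Chain xs
      endArc   : ArcRT (last xs) j y

  composition : Walk → List (G ks)
  composition w = toList (concat (Walk.xs w)) ++ toList (Walk.y w)

  InSeq : List (G ks) → Set
  InSeq c = Σ Walk λ w → composition w ≡ c

  CycleGcdOne : Set
  CycleGcdOne = ∀ (d : ℕ) → (∀ n (vs : Vec V (suc n)) → IsCycle vs → d ∣ suc n) → d ∣ 1

  -- A walk  u u_1 … u_{ℓ-1} v  of length ℓ = suc n
  -- is represented by its interior  w = (u_1,…,u_{ℓ-1}) : Vec V n ;
  -- W is the set 𝒲_R of such walks (as a predicate on interiors).
  Nval : Fin r → ∀ {n} → Vec V n → ℕ
  Nval t w = sum (map (λ x → size x t) (toList w))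

  Condition2 : Fin r → Set₁
  Condition2 t =
    Σ ℕ λ n → Σ V λ u → Σ V λ v → Σ (Vec V n → Set) λ W →
      Rec u × Rec v
      × (∀ w → W w → WalkR u v (suc n) (u ∷ (w ∷ʳ v)))
      × (Σ (Vec V n) W)
      × (Σ (Fin n → Fin r → ℕ) λ φ →
           ∀ w → W w → ∀ j i → (i ≡ t → ⊥) → size (lookup w j) i ≡ φ j i)
      × (∀ (d : ℤ) → (∀ w w' → W w → W w' → d ℤD.∣ ((+ Nval t w) ℤ.- (+ Nval t w')))
                   → d ℤD.∣ (+ 1))

  MComp : ℕ → G ks → Set
  MComp m s = Σ (List (G ks)) λ c → InSeq c × length c ≡ m × sumG c ≡ s

_HasCard_ : Set → ℕ → Set
A HasCard n = Fin n ↔ A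

-- An m-composition of s is a walk ε_s x₁ ⋯ x_a y of D with parts summing to s, where m = (a + 1)σ + b.
-- Splitting off the first arc, their number is the sum, over the H arcs ε_s → x, of the number c_a(x, s)
-- of walks x x₁ ⋯ x_a y with label sum s; as every recurrent vertex has K successors and J arcs into
-- Seq_b(G), Σ_g c_a(x, g) = J K^a.  Strong connectivity, condition 1 (closed walks at z of all large
-- lengths) and condition 2 (closed walks at z shifting the label sum by every unit vector) give L and z
-- such that from every recurrent vertex some walk of length L reaches z with any prescribed label sum.
-- By this Doeblin condition, L steps contract the oscillation of c(·, ·) by the factor ρ / K^L, where
-- ρ = K^L - |G|, so that |G| c_a(x, s) = J K^a + O(ρ^(a/L) K^(a mod L)); Bernoulli's inequality
-- turns the decay (ρ / K^L)^(a/L) into (p / q)^m with p = q - 1.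

module Submission where

open import Axiom.UniquenessOfIdentityProofs.WithK using (uip)
open import Data.Bool.Properties using (T-irrelevant; T?)
open import Data.Empty using (⊥; ⊥-elim)
open import Data.Fin using (Fin; zero; suc; toℕ; fromℕ<; punchIn)
open import Data.Fin.Properties using (toℕ-fromℕ<; toℕ-injective; toℕ<n; punchInᵢ≢i; +↔⊎; *↔×; injective⇒≤; any?)
  renaming (_≟_ to _≟F_)
import Data.Integer as ℤ
import Data.Integer.Divisibility as ℤD
open import Data.Integer.Properties using ([+m]-[+n]≡m⊖n; ⊖-≥; ⊖-≤; ∣-i∣≡∣i∣)
open import Data.List as List using (List; length)
open import Data.List.Properties using (length-++; ++-assoc)
open import Data.Nat using (ℕ; zero; suc; _+_; _*_; _∸_; _^_; _%_; _/_; _≤_; _<_; _≤?_; z≤n; s≤s; NonZero; >-nonZero)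
open import Data.Nat.DivMod
  using (m%n<n; %-distribˡ-+; %-distribˡ-*; [m+kn]%n≡m%n; m%n%n≡m%n; n%n≡0; m<n⇒m%n≡m; m≡m%n+[m/n]*n; /-monoˡ-≤; m*n/n≡m)
open import Data.Nat.Divisibility using (_∣_; ∣-trans; ∣1⇒≡1; ∣m+n∣m⇒∣n)
open import Data.Nat.GCD using (module Bézout; GCD)
open import Data.Nat.Properties
open import Data.Nat.Tactic.RingSolver using (solve-∀)
open import Data.Product using (Σ; ∃; _×_; _,_; proj₁; proj₂)
open import Data.Product.Function.Dependent.Propositional using (Σ-↔)
open import Data.Product.Function.NonDependent.Propositional using (_×-cong_)
open import Data.Sum using (_⊎_; inj₁; inj₂)
open import Data.Sum.Function.Propositional using (_⊎-cong_)
open import Data.Vec using (Vec; []; _∷_; head; last; concat; toList; lookup; _∷ʳ_)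
open import Data.Vec.Properties using (toList-++; length-toList; ≡-dec; last-∷ʳ)
open import Data.Vec.Relation.Unary.All using ([]; _∷_)
open import Defs
open import Effect.Monad using (RawMonad)
open import Function using (_∘_; _↔_; Inverse; mk↔ₛ′; case_of_)
open import Function.Properties.Inverse using (↔-refl; ↔-sym; ↔-trans)
open import Level using (0ℓ)
open import Relation.Binary.Definitions using (DecidableEquality)
open import Relation.Binary.PropositionalEquality
open import Relation.Nullary using (Dec; yes; no; ¬_)
open import Relation.Nullary.Decidable using (decidable-stable; ¬¬-excluded-middle)
open import Relation.Nullary.Negation using (¬¬-Monad; ¬¬-map)

open import Algebra.Properties.Semiring.Sum +-*-semiring using (sum; sum-cong-≗; sum-remove; ∑-distrib-+; ∑-comm; *-distribˡ-sum)
open RawMonad (¬¬-Monad {0ℓ}) using (_>>=_) renaming (pure to ¬¬-pure)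

-- Finite sums

∑-const : ∀ n c → sum {n} (λ _ → c) ≡ n * c
∑-const zero c = refl
∑-const (suc n) c = cong (c +_) (∑-const n c)

∑-mono-≤ : ∀ {n} {f g : Fin n → ℕ} → (∀ i → f i ≤ g i) → sum f ≤ sum g
∑-mono-≤ {zero} f≤g = z≤n
∑-mono-≤ {suc n} f≤g = +-mono-≤ (f≤g zero) (∑-mono-≤ (f≤g ∘ suc))

term≤∑ : ∀ {n} (f : Fin n → ℕ) i → f i ≤ sum f
term≤∑ f zero = m≤m+n _ _
term≤∑ f (suc i) = ≤-trans (term≤∑ (f ∘ suc) i) (m≤n+m _ _)

∑-single : ∀ {n} (f : Fin (suc n) → ℕ) i → (∀ j → j ≢ i → f j ≡ 0) → sum f ≡ f i
∑-single {n} f i off = begin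
  sum f                         ≡⟨ sum-remove f ⟩
  f i + sum (f ∘ punchIn i)     ≡⟨ cong (f i +_) (sum-cong-≗ (λ j → off _ (punchInᵢ≢i i j))) ⟩
  f i + sum {n} (λ _ → 0)       ≡⟨ cong (f i +_) (trans (∑-const n 0) (*-zeroʳ n)) ⟩
  f i + 0                       ≡⟨ +-identityʳ (f i) ⟩
  f i                           ∎
  where open ≡-Reasoning

Within : ℕ → ℕ → ℕ → Set
Within e x y = x ≤ y + e × y ≤ x + e

Within-∑ : ∀ {n} (e x y : Fin n → ℕ) → (∀ i → Within (e i) (x i) (y i)) → Within (sum e) (sum x) (sum y)
Within-∑ e x y within = bound x y (proj₁ ∘ within) , bound y x (proj₂ ∘ within)
  where
  bound : ∀ {n} (x y : Fin n → ℕ) {e : Fin n → ℕ} → (∀ i → x i ≤ y i + e i) → sum x ≤ sum y + sum e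
  bound x y {e} x≤y+e = ≤-trans (∑-mono-≤ x≤y+e) (≤-reflexive (∑-distrib-+ y e))

Within-resp : ∀ {e e′ x x′ y y′} → e ≡ e′ → x ≡ x′ → y ≡ y′ → Within e x y → Within e′ x′ y′
Within-resp refl refl refl within = within

Within⇒∣-∣≤ : ∀ {e x y} → Within e x y → ℤ.∣ ℤ.+ x ℤ.- ℤ.+ y ∣ ≤ e
Within⇒∣-∣≤ {e} {x} {y} (x≤y+e , y≤x+e) rewrite [+m]-[+n]≡m⊖n x y with ≤-total y x
... | inj₁ y≤x rewrite ⊖-≥ y≤x = m≤n+o⇒m∸n≤o x y x≤y+e
... | inj₂ x≤y rewrite ⊖-≤ x≤y | ∣-i∣≡∣i∣ (ℤ.+ (y ∸ x)) = m≤n+o⇒m∸n≤o y x y≤x+e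

𝟙[_] : ∀ {ℓ} {P : Set ℓ} → Dec P → ℕ
𝟙[ yes _ ] = 1
𝟙[ no _ ] = 0

𝟙-yes : ∀ {ℓ} {P : Set ℓ} → P → (d : Dec P) → 𝟙[ d ] ≡ 1
𝟙-yes p (yes _) = refl
𝟙-yes p (no ¬p) = ⊥-elim (¬p p)

𝟙-no : ∀ {ℓ} {P : Set ℓ} → ¬ P → (d : Dec P) → 𝟙[ d ] ≡ 0
𝟙-no ¬p (yes p) = ⊥-elim (¬p p)
𝟙-no ¬p (no _) = refl

¬¬-decide-all : ∀ n (P : Fin n → Set) → ¬ ¬ (∀ i → Dec (P i))
¬¬-decide-all zero P = ¬¬-pure λ ()
¬¬-decide-all (suc n) P = ¬¬-excluded-middle >>= λ P₀? → ¬¬-decide-all n (P ∘ suc) >>= λ P? →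
  ¬¬-pure λ { zero → P₀? ; (suc i) → P? i }

-- The group G

[m%d+n]%d≡[m+n]%d : ∀ m n d .{{_ : NonZero d}} → (m % d + n) % d ≡ (m + n) % d
[m%d+n]%d≡[m+n]%d m n d = begin
  (m % d + n) % d             ≡⟨ %-distribˡ-+ (m % d) n d ⟩
  (m % d % d + n % d) % d     ≡⟨ cong (λ x → (x + n % d) % d) (m%n%n≡m%n m d) ⟩
  (m % d + n % d) % d         ≡⟨ %-distribˡ-+ m n d ⟨
  (m + n) % d                 ∎
  where open ≡-Reasoning

[m+n%d]%d≡[m+n]%d : ∀ m n d .{{_ : NonZero d}} → (m + n % d) % d ≡ (m + n) % d
[m+n%d]%d≡[m+n]%d m n d = begin
  (m + n % d) % d   ≡⟨ cong (_% d) (+-comm m (n % d)) ⟩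
  (n % d + m) % d   ≡⟨ [m%d+n]%d≡[m+n]%d n m d ⟩
  (n + m) % d       ≡⟨ cong (_% d) (+-comm n m) ⟩
  (m + n) % d       ∎
  where open ≡-Reasoning

addMod-toℕ : ∀ {n} (x y : Fin (suc n)) → toℕ (addMod x y) ≡ (toℕ x + toℕ y) % suc n
addMod-toℕ x y = toℕ-fromℕ< _

negMod : ∀ {n} → Fin (suc n) → Fin (suc n)
negMod {n} x = fromℕ< (m%n<n (suc n ∸ toℕ x) (suc n))

addMod-comm : ∀ {n} (x y : Fin (suc n)) → addMod x y ≡ addMod y x
addMod-comm {n} x y = toℕ-injective (begin
  toℕ (addMod x y)           ≡⟨ addMod-toℕ x y ⟩
  (toℕ x + toℕ y) % suc n    ≡⟨ cong (_% suc n) (+-comm (toℕ x) (toℕ y)) ⟩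
  (toℕ y + toℕ x) % suc n    ≡⟨ addMod-toℕ y x ⟨
  toℕ (addMod y x)           ∎)
  where open ≡-Reasoning

addMod-assoc : ∀ {n} (x y z : Fin (suc n)) → addMod (addMod x y) z ≡ addMod x (addMod y z)
addMod-assoc {n} x y z = toℕ-injective (begin
  toℕ (addMod (addMod x y) z)                 ≡⟨ addMod-toℕ (addMod x y) z ⟩
  (toℕ (addMod x y) + toℕ z) % suc n          ≡⟨ cong (λ a → (a + toℕ z) % suc n) (addMod-toℕ x y) ⟩
  ((toℕ x + toℕ y) % suc n + toℕ z) % suc n   ≡⟨ [m%d+n]%d≡[m+n]%d (toℕ x + toℕ y) (toℕ z) (suc n) ⟩
  (toℕ x + toℕ y + toℕ z) % suc n             ≡⟨ cong (_% suc n) (+-assoc (toℕ x) (toℕ y) (toℕ z)) ⟩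
  (toℕ x + (toℕ y + toℕ z)) % suc n           ≡⟨ [m+n%d]%d≡[m+n]%d (toℕ x) (toℕ y + toℕ z) (suc n) ⟨
  (toℕ x + (toℕ y + toℕ z) % suc n) % suc n   ≡⟨ cong (λ a → (toℕ x + a) % suc n) (addMod-toℕ y z) ⟨
  (toℕ x + toℕ (addMod y z)) % suc n          ≡⟨ addMod-toℕ x (addMod y z) ⟨
  toℕ (addMod x (addMod y z))                 ∎)
  where open ≡-Reasoning

addMod-identityˡ : ∀ {n} (x : Fin (suc n)) → addMod zero x ≡ x
addMod-identityˡ x = toℕ-injective (trans (addMod-toℕ zero x) (m<n⇒m%n≡m (toℕ<n x)))

addMod-inverseˡ : ∀ {n} (x : Fin (suc n)) → addMod (negMod x) x ≡ zero
addMod-inverseˡ {n} x = toℕ-injective (begin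
  toℕ (addMod (negMod x) x)                    ≡⟨ addMod-toℕ (negMod x) x ⟩
  (toℕ (negMod x) + toℕ x) % suc n             ≡⟨ cong (λ a → (a + toℕ x) % suc n) (toℕ-fromℕ< (m%n<n (suc n ∸ toℕ x) (suc n))) ⟩
  ((suc n ∸ toℕ x) % suc n + toℕ x) % suc n    ≡⟨ [m%d+n]%d≡[m+n]%d (suc n ∸ toℕ x) (toℕ x) (suc n) ⟩
  (suc n ∸ toℕ x + toℕ x) % suc n              ≡⟨ cong (_% suc n) (m∸n+n≡m (<⇒≤ (toℕ<n x))) ⟩
  suc n % suc n                                ≡⟨ n%n≡0 (suc n) ⟩
  0                                            ∎)
  where open ≡-Reasoning

negG : ∀ {r} {ks : Vec ℕ r} → G ks → G ks
negG [] = []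
negG (x ∷ xs) = negMod x ∷ negG xs

⊕-comm : ∀ {r} {ks : Vec ℕ r} (x y : G ks) → x ⊕ y ≡ y ⊕ x
⊕-comm [] [] = refl
⊕-comm (x ∷ xs) (y ∷ ys) = cong₂ _∷_ (addMod-comm x y) (⊕-comm xs ys)

⊕-assoc : ∀ {r} {ks : Vec ℕ r} (x y z : G ks) → (x ⊕ y) ⊕ z ≡ x ⊕ (y ⊕ z)
⊕-assoc [] [] [] = refl
⊕-assoc (x ∷ xs) (y ∷ ys) (z ∷ zs) = cong₂ _∷_ (addMod-assoc x y z) (⊕-assoc xs ys zs)

⊕-identityˡ : ∀ {r} {ks : Vec ℕ r} (x : G ks) → 0G ⊕ x ≡ x
⊕-identityˡ [] = refl
⊕-identityˡ (x ∷ xs) = cong₂ _∷_ (addMod-identityˡ x) (⊕-identityˡ xs)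

⊕-inverseˡ : ∀ {r} {ks : Vec ℕ r} (x : G ks) → negG x ⊕ x ≡ 0G
⊕-inverseˡ [] = refl
⊕-inverseˡ (x ∷ xs) = cong₂ _∷_ (addMod-inverseˡ x) (⊕-inverseˡ xs)

module _ {r} {ks : Vec ℕ r} where

  infixl 6 _⊖_
  _⊖_ : G ks → G ks → G ks
  g ⊖ x = negG x ⊕ g

  ⊕-interchange : (a b c d : G ks) → (a ⊕ b) ⊕ (c ⊕ d) ≡ (a ⊕ c) ⊕ (b ⊕ d)
  ⊕-interchange a b c d = begin
    (a ⊕ b) ⊕ (c ⊕ d)   ≡⟨ ⊕-assoc a b (c ⊕ d) ⟩
    a ⊕ (b ⊕ (c ⊕ d))   ≡⟨ cong (a ⊕_) (⊕-assoc b c d) ⟨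
    a ⊕ ((b ⊕ c) ⊕ d)   ≡⟨ cong (λ w → a ⊕ (w ⊕ d)) (⊕-comm b c) ⟩
    a ⊕ ((c ⊕ b) ⊕ d)   ≡⟨ cong (a ⊕_) (⊕-assoc c b d) ⟩
    a ⊕ (c ⊕ (b ⊕ d))   ≡⟨ ⊕-assoc a c (b ⊕ d) ⟨
    (a ⊕ c) ⊕ (b ⊕ d)   ∎
    where open ≡-Reasoning

  ⊕-right-comm : ∀ (a b c : G ks) → (a ⊕ b) ⊕ c ≡ (a ⊕ c) ⊕ b
  ⊕-right-comm a b c = trans (⊕-assoc a b c) (trans (cong (a ⊕_) (⊕-comm b c)) (sym (⊕-assoc a c b)))

  ⊕-pull-outʳ : ∀ (a b c e : G ks) → a ⊕ ((b ⊕ e) ⊕ c) ≡ (a ⊕ (b ⊕ c)) ⊕ e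
  ⊕-pull-outʳ a b c e = begin
    a ⊕ ((b ⊕ e) ⊕ c)   ≡⟨ cong (a ⊕_) (⊕-assoc b e c) ⟩
    a ⊕ (b ⊕ (e ⊕ c))   ≡⟨ cong (λ x → a ⊕ (b ⊕ x)) (⊕-comm e c) ⟩
    a ⊕ (b ⊕ (c ⊕ e))   ≡⟨ cong (a ⊕_) (⊕-assoc b c e) ⟨
    a ⊕ ((b ⊕ c) ⊕ e)   ≡⟨ ⊕-assoc a (b ⊕ c) e ⟨
    (a ⊕ (b ⊕ c)) ⊕ e   ∎
    where open ≡-Reasoning

  ⊖-unique : ∀ x y g → x ⊕ y ≡ g → y ≡ g ⊖ x
  ⊖-unique x y g x⊕y≡g = begin
    y                   ≡⟨ ⊕-identityˡ y ⟨
    0G ⊕ y              ≡⟨ cong (_⊕ y) (⊕-inverseˡ x) ⟨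
    (negG x ⊕ x) ⊕ y    ≡⟨ ⊕-assoc (negG x) x y ⟩
    negG x ⊕ (x ⊕ y)    ≡⟨ cong (negG x ⊕_) x⊕y≡g ⟩
    g ⊖ x               ∎
    where open ≡-Reasoning

  ⊕-⊖ : ∀ x g → x ⊕ (g ⊖ x) ≡ g
  ⊕-⊖ x g = begin
    x ⊕ (negG x ⊕ g)    ≡⟨ ⊕-assoc x (negG x) g ⟨
    (x ⊕ negG x) ⊕ g    ≡⟨ cong (_⊕ g) (trans (⊕-comm x (negG x)) (⊕-inverseˡ x)) ⟩
    0G ⊕ g              ≡⟨ ⊕-identityˡ g ⟩
    g                   ∎
    where open ≡-Reasoning

  ⊖-identityʳ : ∀ g → g ⊖ 0G ≡ g
  ⊖-identityʳ g = sym (⊖-unique 0G g g (⊕-identityˡ g))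

  ⊖-⊖ : ∀ g x h → (g ⊖ x) ⊖ h ≡ g ⊖ (x ⊕ h)
  ⊖-⊖ g x h = ⊖-unique (x ⊕ h) _ g (begin
    (x ⊕ h) ⊕ ((g ⊖ x) ⊖ h)   ≡⟨ ⊕-assoc x h _ ⟩
    x ⊕ (h ⊕ ((g ⊖ x) ⊖ h))   ≡⟨ cong (x ⊕_) (⊕-⊖ h (g ⊖ x)) ⟩
    x ⊕ (g ⊖ x)               ≡⟨ ⊕-⊖ x g ⟩
    g                         ∎)
    where open ≡-Reasoning

  ⊖-swap : ∀ g h y → g ⊖ h ≡ y → h ≡ g ⊖ y
  ⊖-swap g h y g⊖h≡y = ⊖-unique y h g (begin
    y ⊕ h         ≡⟨ ⊕-comm y h ⟩
    h ⊕ y         ≡⟨ cong (h ⊕_) g⊖h≡y ⟨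
    h ⊕ (g ⊖ h)   ≡⟨ ⊕-⊖ h g ⟩
    g             ∎)
    where open ≡-Reasoning

sumV : ∀ {r} {ks : Vec ℕ r} {n} → Vec (G ks) n → G ks
sumV v = sumG (toList v)

0<order : ∀ {r} (ks : Vec ℕ r) → 0 < order ks
0<order [] = s≤s z≤n
0<order (k ∷ ks) = *-mono-≤ (s≤s (z≤n {suc k})) (0<order ks)

Fin⇒NonZero : ∀ {n} → Fin n → NonZero n
Fin⇒NonZero {suc n} _ = _

times : ∀ {r} {ks : Vec ℕ r} → ℕ → G ks → G ks
times zero g = 0G
times (suc n) g = g ⊕ times n g

∷-injective : ∀ {r k} {ks : Vec ℕ r} {x y : Fin (modulus k)} {xs ys : G ks}
  → _≡_ {A = G (k ∷ ks)} (x ∷ xs) (y ∷ ys) → x ≡ y × xs ≡ ys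
∷-injective refl = refl , refl

infix 4 _≟G_
_≟G_ : ∀ {r} {ks : Vec ℕ r} (x y : G ks) → Dec (x ≡ y)
[] ≟G [] = yes refl
(x ∷ xs) ≟G (y ∷ ys) with x ≟F y | xs ≟G ys
... | yes refl | yes refl = yes refl
... | no x≢y | _ = no (x≢y ∘ proj₁ ∘ ∷-injective)
... | yes _ | no xs≢ys = no (xs≢ys ∘ proj₂ ∘ ∷-injective)

-- Sums over G

ΣG : ∀ {r} (ks : Vec ℕ r) → (G ks → ℕ) → ℕ
ΣG [] f = f []
ΣG (k ∷ ks) f = sum λ x → ΣG ks λ xs → f (x ∷ xs)

ΣG-cong : ∀ {r} (ks : Vec ℕ r) {f g : G ks → ℕ} → (∀ x → f x ≡ g x) → ΣG ks f ≡ ΣG ks g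
ΣG-cong [] f≗g = f≗g []
ΣG-cong (k ∷ ks) f≗g = sum-cong-≗ λ x → ΣG-cong ks λ xs → f≗g (x ∷ xs)

ΣG-distrib-+ : ∀ {r} (ks : Vec ℕ r) (f g : G ks → ℕ) → ΣG ks (λ x → f x + g x) ≡ ΣG ks f + ΣG ks g
ΣG-distrib-+ [] f g = refl
ΣG-distrib-+ (k ∷ ks) f g = trans (sum-cong-≗ λ x → ΣG-distrib-+ ks (f ∘ (x ∷_)) (g ∘ (x ∷_)))
  (∑-distrib-+ (λ x → ΣG ks (f ∘ (x ∷_))) (λ x → ΣG ks (g ∘ (x ∷_))))

*-distribˡ-ΣG : ∀ {r} (ks : Vec ℕ r) c (f : G ks → ℕ) → c * ΣG ks f ≡ ΣG ks (λ x → c * f x)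
*-distribˡ-ΣG [] c f = refl
*-distribˡ-ΣG (k ∷ ks) c f =
  trans (*-distribˡ-sum c (λ x → ΣG ks (f ∘ (x ∷_)))) (sum-cong-≗ λ x → *-distribˡ-ΣG ks c (f ∘ (x ∷_)))

ΣG-mono-≤ : ∀ {r} (ks : Vec ℕ r) {f g : G ks → ℕ} → (∀ x → f x ≤ g x) → ΣG ks f ≤ ΣG ks g
ΣG-mono-≤ [] f≤g = f≤g []
ΣG-mono-≤ (k ∷ ks) f≤g = ∑-mono-≤ λ x → ΣG-mono-≤ ks λ xs → f≤g (x ∷ xs)

ΣG-const : ∀ {r} (ks : Vec ℕ r) c → ΣG ks (λ _ → c) ≡ order ks * c
ΣG-const [] c = sym (+-identityʳ c)
ΣG-const (k ∷ ks) c = begin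
  sum {modulus k} (λ _ → ΣG ks (λ _ → c))   ≡⟨ sum-cong-≗ {modulus k} (λ _ → ΣG-const ks c) ⟩
  sum {modulus k} (λ _ → order ks * c)      ≡⟨ ∑-const (modulus k) (order ks * c) ⟩
  modulus k * (order ks * c)                ≡⟨ *-assoc (modulus k) (order ks) c ⟨
  order (k ∷ ks) * c                        ∎
  where open ≡-Reasoning

ΣG-split : ∀ {r} (ks : Vec ℕ r) (f : G ks → ℕ) c → (∀ g → c ≤ f g) → ΣG ks f ≡ ΣG ks (λ g → f g ∸ c) + order ks * c
ΣG-split ks f c c≤f = begin
  ΣG ks f                                   ≡⟨ ΣG-cong ks (λ g → sym (m∸n+n≡m (c≤f g))) ⟩
  ΣG ks (λ g → f g ∸ c + c)                 ≡⟨ ΣG-distrib-+ ks (λ g → f g ∸ c) (λ _ → c) ⟩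
  ΣG ks (λ g → f g ∸ c) + ΣG ks (λ _ → c)   ≡⟨ cong (ΣG ks (λ g → f g ∸ c) +_) (ΣG-const ks c) ⟩
  ΣG ks (λ g → f g ∸ c) + order ks * c      ∎
  where open ≡-Reasoning

ΣG-complement : ∀ {r} (ks : Vec ℕ r) (f : G ks → ℕ) c → (∀ g → f g ≤ c) → ΣG ks f + ΣG ks (λ g → c ∸ f g) ≡ order ks * c
ΣG-complement ks f c f≤c = begin
  ΣG ks f + ΣG ks (λ g → c ∸ f g)   ≡⟨ ΣG-distrib-+ ks f (λ g → c ∸ f g) ⟨
  ΣG ks (λ g → f g + (c ∸ f g))     ≡⟨ ΣG-cong ks (λ g → m+[n∸m]≡n (f≤c g)) ⟩
  ΣG ks (λ _ → c)                   ≡⟨ ΣG-const ks c ⟩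
  order ks * c                      ∎
  where open ≡-Reasoning

term≤ΣG : ∀ {r} (ks : Vec ℕ r) (f : G ks → ℕ) x → f x ≤ ΣG ks f
term≤ΣG [] f [] = ≤-refl
term≤ΣG (k ∷ ks) f (x ∷ xs) =
  ≤-trans (term≤ΣG ks (f ∘ (x ∷_)) xs) (term≤∑ (λ y → ΣG ks (f ∘ (y ∷_))) x)

ΣG-∑-comm : ∀ {r} (ks : Vec ℕ r) {n} (f : G ks → Fin n → ℕ)
  → ΣG ks (λ x → sum (f x)) ≡ sum (λ i → ΣG ks (λ x → f x i))
ΣG-∑-comm [] f = refl
ΣG-∑-comm (k ∷ ks) f =
  trans (sum-cong-≗ λ x → ΣG-∑-comm ks (f ∘ (x ∷_))) (∑-comm (λ x i → ΣG ks (λ xs → f (x ∷ xs) i)))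

ΣG-comm : ∀ {r} (ks : Vec ℕ r) (f : G ks → G ks → ℕ)
  → ΣG ks (λ x → ΣG ks (f x)) ≡ ΣG ks (λ y → ΣG ks (λ x → f x y))
ΣG-comm [] f = refl
ΣG-comm (k ∷ ks) f = begin
  sum (λ x → ΣG ks (λ xs → sum (λ y → ΣG ks (λ ys → f (x ∷ xs) (y ∷ ys)))))
    ≡⟨ sum-cong-≗ (λ x → ΣG-∑-comm ks (λ xs y → ΣG ks (λ ys → f (x ∷ xs) (y ∷ ys)))) ⟩
  sum (λ x → sum (λ y → ΣG ks (λ xs → ΣG ks (λ ys → f (x ∷ xs) (y ∷ ys)))))
    ≡⟨ ∑-comm (λ x y → ΣG ks (λ xs → ΣG ks (λ ys → f (x ∷ xs) (y ∷ ys)))) ⟩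
  sum (λ y → sum (λ x → ΣG ks (λ xs → ΣG ks (λ ys → f (x ∷ xs) (y ∷ ys)))))
    ≡⟨ sum-cong-≗ (λ y → sum-cong-≗ (λ x → ΣG-comm ks (λ xs ys → f (x ∷ xs) (y ∷ ys)))) ⟩
  sum (λ y → sum (λ x → ΣG ks (λ ys → ΣG ks (λ xs → f (x ∷ xs) (y ∷ ys)))))
    ≡⟨ sum-cong-≗ (λ y → ΣG-∑-comm ks (λ ys x → ΣG ks (λ xs → f (x ∷ xs) (y ∷ ys)))) ⟨
  sum (λ y → ΣG ks (λ ys → sum (λ x → ΣG ks (λ xs → f (x ∷ xs) (y ∷ ys)))))
    ∎
  where open ≡-Reasoning

ΣG-single : ∀ {r} (ks : Vec ℕ r) (f : G ks → ℕ) y → (∀ x → x ≢ y → f x ≡ 0) → ΣG ks f ≡ f y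
ΣG-single [] f [] off = refl
ΣG-single (k ∷ ks) f (y ∷ ys) off = begin
  sum (λ x → ΣG ks (λ xs → f (x ∷ xs)))   ≡⟨ ∑-single _ y off-row ⟩
  ΣG ks (λ xs → f (y ∷ xs))               ≡⟨ ΣG-single ks (f ∘ (y ∷_)) ys (λ xs xs≢ys → off _ (xs≢ys ∘ proj₂ ∘ ∷-injective)) ⟩
  f (y ∷ ys)                              ∎
  where
  open ≡-Reasoning
  off-row : ∀ x → x ≢ y → ΣG ks (λ xs → f (x ∷ xs)) ≡ 0
  off-row x x≢y = begin
    ΣG ks (λ xs → f (x ∷ xs))   ≡⟨ ΣG-cong ks (λ xs → off _ (x≢y ∘ proj₁ ∘ ∷-injective)) ⟩
    ΣG ks (λ _ → 0)             ≡⟨ ΣG-const ks 0 ⟩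
    order ks * 0                ≡⟨ *-zeroʳ (order ks) ⟩
    0                           ∎

ΣG-pick : ∀ {r} (ks : Vec ℕ r) (f : G ks → ℕ) y → ΣG ks (λ x → 𝟙[ x ≟G y ] * f x) ≡ f y
ΣG-pick ks f y = trans (ΣG-single ks _ y (λ x x≢y → cong (_* f x) (𝟙-no x≢y (x ≟G y))))
                       (trans (cong (_* f y) (𝟙-yes refl (y ≟G y))) (+-identityʳ (f y)))

ΣG-reindex : ∀ {r} (ks : Vec ℕ r) (f : G ks → ℕ) (φ ψ : G ks → G ks)
  → (∀ x → ψ (φ x) ≡ x) → (∀ y → φ (ψ y) ≡ y) → ΣG ks (f ∘ φ) ≡ ΣG ks f
ΣG-reindex ks f φ ψ ψφ φψ = begin
  ΣG ks (f ∘ φ)                                      ≡⟨ ΣG-cong ks (λ x → ΣG-pick ks f (φ x)) ⟨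
  ΣG ks (λ x → ΣG ks (λ y → 𝟙[ y ≟G φ x ] * f y))   ≡⟨ ΣG-comm ks (λ x y → 𝟙[ y ≟G φ x ] * f y) ⟩
  ΣG ks (λ y → ΣG ks (λ x → 𝟙[ y ≟G φ x ] * f y))   ≡⟨ ΣG-cong ks (λ y → ΣG-single ks _ (ψ y) (off y)) ⟩
  ΣG ks (λ y → 𝟙[ y ≟G φ (ψ y) ] * f y)             ≡⟨ ΣG-cong ks (λ y → cong (_* f y) (𝟙-yes (sym (φψ y)) (y ≟G φ (ψ y)))) ⟩
  ΣG ks (λ y → 1 * f y)                              ≡⟨ ΣG-cong ks (λ y → *-identityˡ (f y)) ⟩
  ΣG ks f                                            ∎
  where
  open ≡-Reasoning
  off : ∀ y x → x ≢ ψ y → 𝟙[ y ≟G φ x ] * f y ≡ 0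
  off y x x≢ψy = cong (_* f y) (𝟙-no (λ y≡φx → x≢ψy (trans (sym (ψφ x)) (cong ψ (sym y≡φx)))) (y ≟G φ x))

ΣG-translate : ∀ {r} (ks : Vec ℕ r) (f : G ks → ℕ) x → ΣG ks (λ g → f (g ⊖ x)) ≡ ΣG ks f
ΣG-translate ks f x = ΣG-reindex ks f (_⊖ x) (x ⊕_) (⊕-⊖ x) (λ y → sym (⊖-unique x y _ refl))

ΣG-reflect : ∀ {r} (ks : Vec ℕ r) (f : G ks → ℕ) g → ΣG ks (λ h → f (g ⊖ h)) ≡ ΣG ks f
ΣG-reflect ks f g = ΣG-reindex ks f (g ⊖_) (g ⊖_) involutive involutive
  where
  involutive : ∀ h → g ⊖ (g ⊖ h) ≡ h
  involutive h = sym (⊖-swap g h _ refl)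

-- Modular Bézout identities

module _ (k : ℕ) where

  +-cong-mod : ∀ c {a b} → a % suc k ≡ b % suc k → (c + a) % suc k ≡ (c + b) % suc k
  +-cong-mod c {a} {b} a≡b = begin
    (c + a) % suc k          ≡⟨ [m+n%d]%d≡[m+n]%d c a (suc k) ⟨
    (c + a % suc k) % suc k  ≡⟨ cong (λ x → (c + x) % suc k) a≡b ⟩
    (c + b % suc k) % suc k  ≡⟨ [m+n%d]%d≡[m+n]%d c b (suc k) ⟩
    (c + b) % suc k          ∎
    where open ≡-Reasoning

  *-cong-mod : ∀ c {a b} → a % suc k ≡ b % suc k → (c * a) % suc k ≡ (c * b) % suc k
  *-cong-mod c {a} {b} a≡b = begin
    (c * a) % suc k                       ≡⟨ %-distribˡ-* c a (suc k) ⟩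
    (c % suc k * (a % suc k)) % suc k     ≡⟨ cong (λ x → (c % suc k * x) % suc k) a≡b ⟩
    (c % suc k * (b % suc k)) % suc k     ≡⟨ %-distribˡ-* c b (suc k) ⟨
    (c * b) % suc k                       ∎
    where open ≡-Reasoning

  ∑-cong-mod : ∀ {n} (f g : Fin n → ℕ) → (∀ i → f i % suc k ≡ g i % suc k) → sum f % suc k ≡ sum g % suc k
  ∑-cong-mod {zero} f g f≡g = refl
  ∑-cong-mod {suc n} f g f≡g = begin
    (f zero + sum (f ∘ suc)) % suc k                    ≡⟨ %-distribˡ-+ (f zero) (sum (f ∘ suc)) (suc k) ⟩
    (f zero % suc k + sum (f ∘ suc) % suc k) % suc k
      ≡⟨ cong₂ (λ a b → (a + b) % suc k) (f≡g zero) (∑-cong-mod (f ∘ suc) (g ∘ suc) (f≡g ∘ suc)) ⟩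
    (g zero % suc k + sum (g ∘ suc) % suc k) % suc k    ≡⟨ %-distribˡ-+ (g zero) (sum (g ∘ suc)) (suc k) ⟨
    (g zero + sum (g ∘ suc)) % suc k                    ∎
    where open ≡-Reasoning

  record ModBezout {M} (R : Fin M → ℕ) : Set where
    field
      divisor : ℕ
      coefficient : Fin M → ℕ
      divisor∣ : ∀ i → divisor ∣ R i
      combination : sum (λ i → coefficient i * R i) % suc k ≡ divisor % suc k

  mod-bezout : ∀ {M} (R : Fin M → ℕ) → ModBezout R
  mod-bezout {zero} R = record { divisor = suc k ; coefficient = λ () ; divisor∣ = λ () ; combination = sym (n%n≡0 (suc k)) }
  mod-bezout {suc M} R with mod-bezout (R ∘ suc)
  ... | record { divisor = g ; coefficient = X ; divisor∣ = g∣R ; combination = combination } with Bézout.lemma g (R zero)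
  ...   | Bézout.result d gcd identity = record
    { divisor = d ; coefficient = X′ identity ; divisor∣ = d∣R ; combination = combination′ identity }
    where
    d∣g : d ∣ g
    d∣g = proj₁ (GCD.commonDivisor gcd)
    d∣R : ∀ i → d ∣ R i
    d∣R zero = proj₂ (GCD.commonDivisor gcd)
    d∣R (suc i) = ∣-trans d∣g (g∣R i)
    S : ℕ
    S = sum (λ i → X i * R (suc i))
    -- a negative Bézout coefficient is multiplied by k ≡ -1 (mod k + 1)
    X′ : Bézout.Identity d g (R zero) → Fin (suc M) → ℕ
    X′ (Bézout.+- x y _) zero = y * k
    X′ (Bézout.+- x y _) (suc i) = x * X i
    X′ (Bézout.-+ x y _) zero = y
    X′ (Bézout.-+ x y _) (suc i) = x * k * X i
    scaled : ∀ c → sum (λ i → c * X i * R (suc i)) ≡ c * S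
    scaled c = trans (sum-cong-≗ λ i → *-assoc c (X i) (R (suc i))) (sym (*-distribˡ-sum c (λ i → X i * R (suc i))))
    combination′ : ∀ identity → sum (λ i → X′ identity i * R i) % suc k ≡ d % suc k
    combination′ (Bézout.+- x y d+yR≡xg) = begin
      (y * k * R zero + sum (λ i → x * X i * R (suc i))) % suc k ≡⟨ cong (λ s → (y * k * R zero + s) % suc k) (scaled x) ⟩
      (y * k * R zero + x * S) % suc k                           ≡⟨ +-cong-mod (y * k * R zero) (*-cong-mod x combination) ⟩
      (y * k * R zero + x * g) % suc k                           ≡⟨ cong (λ s → (y * k * R zero + s) % suc k) (sym d+yR≡xg) ⟩
      (y * k * R zero + (d + y * R zero)) % suc k                ≡⟨ cong (_% suc k) (rearrange y k (R zero) d) ⟩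
      (d + y * R zero * suc k) % suc k                           ≡⟨ [m+kn]%n≡m%n d (y * R zero) (suc k) ⟩
      d % suc k                                                  ∎
      where
      open ≡-Reasoning
      rearrange : ∀ y k R d → y * k * R + (d + y * R) ≡ d + y * R * suc k
      rearrange = solve-∀
    combination′ (Bézout.-+ x y d+xg≡yR) = begin
      (y * R zero + sum (λ i → x * k * X i * R (suc i))) % suc k ≡⟨ cong (λ s → (y * R zero + s) % suc k) (scaled (x * k)) ⟩
      (y * R zero + x * k * S) % suc k                           ≡⟨ +-cong-mod (y * R zero) (*-cong-mod (x * k) combination) ⟩
      (y * R zero + x * k * g) % suc k                           ≡⟨ cong (λ s → (s + x * k * g) % suc k) (sym d+xg≡yR) ⟩
      (d + x * g + x * k * g) % suc k                            ≡⟨ cong (_% suc k) (rearrange x k g d) ⟩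
      (d + x * g * suc k) % suc k                                ≡⟨ [m+kn]%n≡m%n d (x * g) (suc k) ⟩
      d % suc k                                                  ∎
      where
      open ≡-Reasoning
      rearrange : ∀ x k g d → d + x * g + x * k * g ≡ d + x * g * suc k
      rearrange = solve-∀

  mod-bezout-solve : ∀ {M} (R X : Fin M → ℕ) → sum (λ i → X i * R i) % suc k ≡ 1 % suc k
    → ∀ y → sum (λ i → (y * X i) % suc k * R i) % suc k ≡ y % suc k
  mod-bezout-solve R X combination y = begin
    sum (λ i → (y * X i) % suc k * R i) % suc k   ≡⟨ ∑-cong-mod _ _ reduce ⟩
    sum (λ i → y * X i * R i) % suc k             ≡⟨ cong (_% suc k) (trans (sum-cong-≗ λ i → *-assoc y (X i) (R i))
                                                                            (sym (*-distribˡ-sum y (λ i → X i * R i)))) ⟩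
    (y * sum (λ i → X i * R i)) % suc k           ≡⟨ *-cong-mod y combination ⟩
    (y * 1) % suc k                               ≡⟨ cong (_% suc k) (*-identityʳ y) ⟩
    y % suc k                                     ∎
    where
    open ≡-Reasoning
    reduce : ∀ i → (y * X i) % suc k * R i % suc k ≡ y * X i * R i % suc k
    reduce i = begin
      (y * X i) % suc k * R i % suc k                  ≡⟨ %-distribˡ-* ((y * X i) % suc k) (R i) (suc k) ⟩
      (y * X i) % suc k % suc k * (R i % suc k) % suc k ≡⟨ cong (λ a → a * (R i % suc k) % suc k) (m%n%n≡m%n (y * X i) (suc k)) ⟩
      (y * X i) % suc k * (R i % suc k) % suc k        ≡⟨ %-distribˡ-* (y * X i) (R i) (suc k) ⟨
      y * X i * R i % suc k                            ∎

+-∸-split : ∀ {m n} c → n ≤ m → m + c ≡ n + c + (m ∸ n)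
+-∸-split {m} {n} c n≤m = trans (cong (_+ c) (sym (m+[n∸m]≡n n≤m))) (rearrange n (m ∸ n) c)
  where
  rearrange : ∀ x y z → x + y + z ≡ x + z + y
  rearrange = solve-∀

∣-difference : ∀ g a b c → g ∣ a + c → g ∣ b + c → g ∣ ℤ.∣ ℤ.+ a ℤ.- ℤ.+ b ∣
∣-difference g a b c g∣a+c g∣b+c rewrite [+m]-[+n]≡m⊖n a b with ≤-total b a
... | inj₁ b≤a rewrite ⊖-≥ b≤a = ∣m+n∣m⇒∣n (subst (g ∣_) (+-∸-split c b≤a) g∣a+c) g∣b+c
... | inj₂ a≤b rewrite ⊖-≤ a≤b | ∣-i∣≡∣i∣ (ℤ.+ (b ∸ a)) = ∣m+n∣m⇒∣n (subst (g ∣_) (+-∸-split c a≤b) g∣b+c) g∣a+c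

-- Exponential decay

bernoulli : ∀ p n → suc p ^ suc n ≤ suc p * p ^ n + n * suc p ^ n
bernoulli p zero = ≤-reflexive (sym (+-identityʳ (suc p * 1)))
bernoulli p (suc n) = begin
  suc p * suc p ^ suc n                                   ≤⟨ *-monoʳ-≤ (suc p) (bernoulli p n) ⟩
  suc p * (suc p * p ^ n + n * suc p ^ n)                 ≡⟨ expand p n (p ^ n) (suc p ^ n) ⟩
  suc p * p ^ n + p * (suc p * p ^ n) + n * suc p ^ suc n ≤⟨ +-monoˡ-≤ _ (+-monoˡ-≤ _ (*-monoʳ-≤ (suc p) (^-monoˡ-≤ n (n≤1+n p)))) ⟩
  suc p ^ suc n + p * (suc p * p ^ n) + n * suc p ^ suc n ≡⟨ collect p n (p ^ n) (suc p ^ n) ⟩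
  suc p * p ^ suc n + suc n * suc p ^ suc n               ∎
  where
  open ≤-Reasoning
  expand : ∀ p n a b → suc p * (suc p * a + n * b) ≡ suc p * a + p * (suc p * a) + n * (suc p * b)
  expand = solve-∀
  collect : ∀ p n a b → suc p * b + p * (suc p * a) + n * (suc p * b) ≡ suc p * (p * a) + suc n * (suc p * b)
  collect = solve-∀

-- with q = n (X + 1) and n ≥ 1, Bernoulli gives (1 - 1/q) ^ n ≥ 1 - 1/(X + 1) ≥ ρ / X
ratio-bound : ∀ n X ρ p → .{{NonZero n}} → suc p ≡ n * suc X → ρ < X → ρ * suc p ^ n ≤ X * p ^ n
ratio-bound n X ρ p q≡ ρ<X = *-cancelʳ-≤ (ρ * q ^ n) (X * p ^ n) q (begin
  ρ * q ^ n * q                  ≡⟨ cong (λ c → ρ * q ^ n * c) q≡ ⟩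
  ρ * q ^ n * (n * suc X)        ≡⟨ shuffle₁ ρ (q ^ n) n X ⟩
  n * (ρ * X + ρ) * q ^ n        ≤⟨ *-monoˡ-≤ (q ^ n) (*-monoʳ-≤ n ρX+ρ≤XX) ⟩
  n * (X * X) * q ^ n            ≤⟨ +-cancelʳ-≤ (X * n * q ^ n) _ _ bound ⟩
  X * p ^ n * q                  ∎)
  where
  open ≤-Reasoning
  q : ℕ
  q = suc p
  ρX+ρ≤XX : ρ * X + ρ ≤ X * X
  ρX+ρ≤XX = begin
    ρ * X + ρ   ≤⟨ +-monoʳ-≤ (ρ * X) (<⇒≤ ρ<X) ⟩
    ρ * X + X   ≡⟨ +-comm (ρ * X) X ⟩
    suc ρ * X   ≤⟨ *-monoˡ-≤ X ρ<X ⟩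
    X * X       ∎
  shuffle₁ : ∀ ρ Q n X → ρ * Q * (n * suc X) ≡ n * (ρ * X + ρ) * Q
  shuffle₁ = solve-∀
  bound : n * (X * X) * q ^ n + X * n * q ^ n ≤ X * p ^ n * q + X * n * q ^ n
  bound = begin
    n * (X * X) * q ^ n + X * n * q ^ n   ≡⟨ shuffle₂ n X (q ^ n) ⟩
    X * (q ^ n * (n * suc X))             ≡⟨ cong (λ c → X * (q ^ n * c)) q≡ ⟨
    X * (q ^ n * q)                       ≡⟨ cong (X *_) (*-comm (q ^ n) q) ⟩
    X * q ^ suc n                         ≤⟨ *-monoʳ-≤ X (bernoulli p n) ⟩
    X * (q * p ^ n + n * q ^ n)           ≡⟨ shuffle₃ X q (p ^ n) n (q ^ n) ⟩
    X * p ^ n * q + X * n * q ^ n         ∎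
    where
    shuffle₂ : ∀ n X Q → n * (X * X) * Q + X * n * Q ≡ X * (Q * (n * suc X))
    shuffle₂ = solve-∀
    shuffle₃ : ∀ X q P n Q → X * (q * P + n * Q) ≡ X * P * q + X * n * Q
    shuffle₃ = solve-∀

geometric-decay : ∀ {ρ X p q R e} A B → ρ * q ^ R ≤ X * p ^ R → A * q ^ e ≤ B * p ^ e
  → ∀ j → ρ ^ j * A * q ^ (j * R + e) ≤ X ^ j * B * p ^ (j * R + e)
geometric-decay {p = p} {q = q} {e = e} A B step base zero =
  subst₂ _≤_ (cong (_* q ^ e) (sym (+-identityʳ A))) (cong (_* p ^ e) (sym (+-identityʳ B))) base
geometric-decay {ρ} {X} {p} {q} {R} {e} A B step base (suc j) = begin
  ρ * ρ ^ j * A * q ^ (R + j * R + e)           ≡⟨ cong (λ m → ρ * ρ ^ j * A * q ^ m) (+-assoc R (j * R) e) ⟩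
  ρ * ρ ^ j * A * q ^ (R + (j * R + e))         ≡⟨ cong (ρ * ρ ^ j * A *_) (^-distribˡ-+-* q R (j * R + e)) ⟩
  ρ * ρ ^ j * A * (q ^ R * q ^ (j * R + e))     ≡⟨ shuffle ρ (ρ ^ j) A (q ^ R) (q ^ (j * R + e)) ⟩
  (ρ * q ^ R) * (ρ ^ j * A * q ^ (j * R + e))   ≤⟨ *-mono-≤ step (geometric-decay A B step base j) ⟩
  (X * p ^ R) * (X ^ j * B * p ^ (j * R + e))   ≡⟨ shuffle X (X ^ j) B (p ^ R) (p ^ (j * R + e)) ⟨
  X * X ^ j * B * (p ^ R * p ^ (j * R + e))     ≡⟨ cong (X * X ^ j * B *_) (^-distribˡ-+-* p R (j * R + e)) ⟨
  X * X ^ j * B * p ^ (R + (j * R + e))         ≡⟨ cong (λ m → X * X ^ j * B * p ^ m) (+-assoc R (j * R) e) ⟨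
  X * X ^ j * B * p ^ (R + j * R + e)           ∎
  where
  open ≤-Reasoning
  shuffle : ∀ a b c d f → a * b * c * (d * f) ≡ (a * d) * (b * c * f)
  shuffle = solve-∀

error-regroup : ∀ g x k j → g * (x * (k * j)) ≡ j * g * (x * k)
error-regroup = solve-∀

error-factor : ∀ h j g y Q → h * (j * g * y) * Q ≡ h * j * g * (y * Q)
error-factor = solve-∀

main-factor : ∀ h g c k P → h * g * (c * k * P) ≡ g * c * (h * k) * P
main-factor = solve-∀

exponential-bound : ∀ L σ K ρ → .{{NonZero L}} → .{{NonZero σ}} → ρ < K ^ L
  → ∃ λ p → ∃ λ q → ∃ λ C → 0 < p × p < q × ∀ j r₀ b → r₀ < L → b < σ
    → ρ ^ j * K ^ r₀ * q ^ (suc (j * L + r₀) * σ + b) ≤ C * K ^ (j * L + r₀) * p ^ (suc (j * L + r₀) * σ + b)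
exponential-bound (suc L′) (suc σ′) K ρ ρ<X = p , suc p , C , 0<p , n<1+n p , bound
  where
  L σ X R p C : ℕ
  L = suc L′
  σ = suc σ′
  X = K ^ L
  R = L * σ
  -- p = R * suc X ∸ 1, written so that suc p reduces to R * suc X
  p = X + (σ′ + L′ * σ) * suc X
  C = suc p ^ (2 * R)
  0<p : 0 < p
  0<p = ≤-trans (≤-trans (s≤s z≤n) ρ<X) (m≤m+n X _)
  bound : ∀ j r₀ b → r₀ < L → b < σ
    → ρ ^ j * K ^ r₀ * suc p ^ (suc (j * L + r₀) * σ + b) ≤ C * K ^ (j * L + r₀) * p ^ (suc (j * L + r₀) * σ + b)
  bound j r₀ b r₀<L b<σ = begin
    ρ ^ j * K ^ r₀ * suc p ^ (suc (j * L + r₀) * σ + b)   ≡⟨ cong (λ m → ρ ^ j * K ^ r₀ * suc p ^ m) exponent ⟩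
    ρ ^ j * K ^ r₀ * suc p ^ (j * R + e)                  ≤⟨ geometric-decay (K ^ r₀) (C * K ^ r₀) (ratio-bound R X ρ p refl ρ<X) base j ⟩
    X ^ j * (C * K ^ r₀) * p ^ (j * R + e)                ≡⟨ coefficient (X ^ j) C (K ^ r₀) (p ^ (j * R + e)) ⟩
    C * (X ^ j * K ^ r₀) * p ^ (j * R + e)                ≡⟨ cong₂ (λ k m → C * k * p ^ m) Kʲᴸ⁺ʳ⁰ (sym exponent) ⟩
    C * K ^ (j * L + r₀) * p ^ (suc (j * L + r₀) * σ + b) ∎
    where
    open ≤-Reasoning
    e : ℕ
    e = suc r₀ * σ + b
    exponent : suc (j * L + r₀) * σ + b ≡ j * R + e
    exponent = distribute j L r₀ σ b
      where
      distribute : ∀ j L r σ b → suc (j * L + r) * σ + b ≡ j * (L * σ) + (suc r * σ + b)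
      distribute = solve-∀
    coefficient : ∀ x c k P → x * (c * k) * P ≡ c * (x * k) * P
    coefficient = solve-∀
    Kʲᴸ⁺ʳ⁰ : X ^ j * K ^ r₀ ≡ K ^ (j * L + r₀)
    Kʲᴸ⁺ʳ⁰ = trans (cong (_* K ^ r₀) (trans (^-*-assoc K L j) (cong (K ^_) (*-comm L j)))) (sym (^-distribˡ-+-* K (j * L) r₀))
    e≤2R : e ≤ 2 * R
    e≤2R = begin
      suc r₀ * σ + b   ≤⟨ +-mono-≤ (*-monoˡ-≤ σ r₀<L) (<⇒≤ b<σ) ⟩
      L * σ + σ        ≤⟨ +-monoʳ-≤ (L * σ) (m≤m*n σ L) ⟩
      L * σ + σ * L    ≡⟨ cong (L * σ +_) (trans (*-comm σ L) (sym (+-identityʳ (L * σ)))) ⟩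
      2 * R            ∎
      where open ≤-Reasoning
    base : K ^ r₀ * suc p ^ e ≤ C * K ^ r₀ * p ^ e
    base = begin
      K ^ r₀ * suc p ^ e       ≤⟨ *-monoʳ-≤ (K ^ r₀) (^-monoʳ-≤ (suc p) e≤2R) ⟩
      K ^ r₀ * C               ≡⟨ *-comm (K ^ r₀) C ⟩
      C * K ^ r₀               ≤⟨ m≤m*n (C * K ^ r₀) (p ^ e) ⟩
      C * K ^ r₀ * p ^ e       ∎
      where
      open ≤-Reasoning
      instance
        _ : NonZero (p ^ e)
        _ = m^n≢0 p e {{>-nonZero 0<p}}

-- Coordinates and unit vectors

modulusAt : ∀ {r} → Vec ℕ r → Fin r → ℕ
modulusAt ks t = modulus (lookup ks t)

coord-⊕ : ∀ {r} {ks : Vec ℕ r} (x y : G ks) i → coord (x ⊕ y) i ≡ (coord x i + coord y i) % modulusAt ks i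
coord-⊕ (x ∷ xs) (y ∷ ys) zero = addMod-toℕ x y
coord-⊕ (x ∷ xs) (y ∷ ys) (suc i) = coord-⊕ xs ys i

coord-0G : ∀ {r} (ks : Vec ℕ r) i → coord (0G {ks = ks}) i ≡ 0
coord-0G (k ∷ ks) zero = refl
coord-0G (k ∷ ks) (suc i) = coord-0G ks i

coord< : ∀ {r} {ks : Vec ℕ r} (x : G ks) i → coord x i < modulusAt ks i
coord< (x ∷ xs) zero = toℕ<n x
coord< (x ∷ xs) (suc i) = coord< xs i

coord-injective : ∀ {r} {ks : Vec ℕ r} (x y : G ks) → (∀ i → coord x i ≡ coord y i) → x ≡ y
coord-injective [] [] _ = refl
coord-injective (x ∷ xs) (y ∷ ys) same = cong₂ _∷_ (toℕ-injective (same zero)) (coord-injective xs ys (same ∘ suc))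

coord-sumV : ∀ {r} {ks : Vec ℕ r} {n} (xs : Vec (G ks) n) i → coord (sumV xs) i ≡ size xs i % modulusAt ks i
coord-sumV {ks = ks} [] i = coord-0G ks i
coord-sumV {ks = ks} (x ∷ xs) i = begin
  coord (x ⊕ sumV xs) i                                       ≡⟨ coord-⊕ x (sumV xs) i ⟩
  (coord x i + coord (sumV xs) i) % modulusAt ks i            ≡⟨ cong (λ c → (coord x i + c) % modulusAt ks i) (coord-sumV xs i) ⟩
  (coord x i + size xs i % modulusAt ks i) % modulusAt ks i   ≡⟨ [m+n%d]%d≡[m+n]%d (coord x i) (size xs i) (modulusAt ks i) ⟩
  (coord x i + size xs i) % modulusAt ks i                    ∎
  where open ≡-Reasoning

unit : ∀ {r} {ks : Vec ℕ r} → Fin r → ℕ → G ks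
unit {ks = k ∷ ks} zero a = fromℕ< (m%n<n a (modulus k)) ∷ 0G
unit {ks = k ∷ ks} (suc t) a = zero ∷ unit t a

coord-unit-≡ : ∀ {r} (ks : Vec ℕ r) t a → coord (unit {ks = ks} t a) t ≡ a % modulusAt ks t
coord-unit-≡ (k ∷ ks) zero a = toℕ-fromℕ< (m%n<n a (modulus k))
coord-unit-≡ (k ∷ ks) (suc t) a = coord-unit-≡ ks t a

coord-unit-≢ : ∀ {r} (ks : Vec ℕ r) t a i → i ≢ t → coord (unit {ks = ks} t a) i ≡ 0
coord-unit-≢ (k ∷ ks) zero a zero i≢t = ⊥-elim (i≢t refl)
coord-unit-≢ (k ∷ ks) zero a (suc i) _ = coord-0G ks i
coord-unit-≢ (k ∷ ks) (suc t) a zero _ = refl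
coord-unit-≢ (k ∷ ks) (suc t) a (suc i) i≢t = coord-unit-≢ ks t a i (i≢t ∘ cong suc)

coord-ext-at : ∀ {r} {ks : Vec ℕ r} {x y : G ks} t
  → coord x t ≡ coord y t → (∀ i → i ≢ t → coord x i ≡ coord y i) → x ≡ y
coord-ext-at {x = x} {y} t same-t same-else = coord-injective x y λ i → case i ≟F t of λ where
  (yes refl) → same-t
  (no i≢t) → same-else i i≢t

unit-+ : ∀ {r} {ks : Vec ℕ r} t a b → unit {ks = ks} t (a + b) ≡ unit t a ⊕ unit t b
unit-+ {ks = ks} t a b = coord-ext-at t
  (begin
    coord (u (a + b)) t                           ≡⟨ coord-unit-≡ ks t (a + b) ⟩
    (a + b) % k                                   ≡⟨ %-distribˡ-+ a b k ⟩
    (a % k + b % k) % k                           ≡⟨ cong₂ (λ c d → (c + d) % k) (coord-unit-≡ ks t a) (coord-unit-≡ ks t b) ⟨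
    (coord (u a) t + coord (u b) t) % k           ≡⟨ coord-⊕ (u a) (u b) t ⟨
    coord (u a ⊕ u b) t                           ∎)
  (λ i i≢t → trans (coord-unit-≢ ks t (a + b) i i≢t) (sym (trans (coord-⊕ (u a) (u b) i)
    (cong₂ (λ c d → (c + d) % modulusAt ks i) (coord-unit-≢ ks t a i i≢t) (coord-unit-≢ ks t b i i≢t)))))
  where
  open ≡-Reasoning
  k : ℕ
  k = modulusAt ks t
  u : ℕ → G ks
  u = unit t

unit-mod : ∀ {r} {ks : Vec ℕ r} t a b → a % modulusAt ks t ≡ b % modulusAt ks t → unit {ks = ks} t a ≡ unit t b
unit-mod {ks = ks} t a b a≡b = coord-ext-at t
  (trans (coord-unit-≡ ks t a) (trans a≡b (sym (coord-unit-≡ ks t b))))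
  (λ i i≢t → trans (coord-unit-≢ ks t a i i≢t) (sym (coord-unit-≢ ks t b i i≢t)))

unit-zero : ∀ {r} {ks : Vec ℕ r} t → unit {ks = ks} t 0 ≡ 0G
unit-zero {ks = ks} t = coord-ext-at t
  (trans (coord-unit-≡ ks t 0) (sym (coord-0G ks t)))
  (λ i i≢t → trans (coord-unit-≢ ks t 0 i i≢t) (sym (coord-0G ks i)))

times-unit : ∀ {r} {ks : Vec ℕ r} n t a → times n (unit {ks = ks} t a) ≡ unit t (n * a)
times-unit zero t a = sym (unit-zero t)
times-unit (suc n) t a = trans (cong (unit t a ⊕_) (times-unit n t a)) (sym (unit-+ t a (n * a)))

times-⊕ : ∀ {r} {ks : Vec ℕ r} n (g h : G ks) → times n (g ⊕ h) ≡ times n g ⊕ times n h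
times-⊕ zero g h = sym (⊕-identityˡ 0G)
times-⊕ (suc n) g h = trans (cong ((g ⊕ h) ⊕_) (times-⊕ n g h)) (⊕-interchange g h (times n g) (times n h))

times-+ : ∀ {r} {ks : Vec ℕ r} m n (g : G ks) → times (m + n) g ≡ times m g ⊕ times n g
times-+ zero n g = sym (⊕-identityˡ (times n g))
times-+ (suc m) n g = trans (cong (g ⊕_) (times-+ m n g)) (sym (⊕-assoc g (times m g) (times n g)))

⨁ : ∀ {r} {ks : Vec ℕ r} n → (Fin n → G ks) → G ks
⨁ zero f = 0G
⨁ (suc n) f = f zero ⊕ ⨁ n (f ∘ suc)

⨁-⊕ : ∀ {r} {ks : Vec ℕ r} n (f g : Fin n → G ks) → ⨁ n (λ i → f i ⊕ g i) ≡ ⨁ n f ⊕ ⨁ n g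
⨁-⊕ zero f g = sym (⊕-identityˡ 0G)
⨁-⊕ (suc n) f g = trans (cong ((f zero ⊕ g zero) ⊕_) (⨁-⊕ n (f ∘ suc) (g ∘ suc)))
                        (⊕-interchange (f zero) (g zero) (⨁ n (f ∘ suc)) (⨁ n (g ∘ suc)))

⨁-unit : ∀ {r} {ks : Vec ℕ r} n t (y : Fin n → ℕ) → ⨁ n (λ i → unit {ks = ks} t (y i)) ≡ unit t (sum y)
⨁-unit zero t y = sym (unit-zero t)
⨁-unit (suc n) t y = trans (cong (unit t (y zero) ⊕_) (⨁-unit n t (y ∘ suc))) (sym (unit-+ t (y zero) (sum (y ∘ suc))))

⨁-zero∷ : ∀ {r k} {ks : Vec ℕ r} n (f : Fin n → G ks) → ⨁ {ks = k ∷ ks} n (λ i → zero ∷ f i) ≡ zero ∷ ⨁ n f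
⨁-zero∷ zero f = refl
⨁-zero∷ (suc n) f = trans (cong ((zero ∷ f zero) ⊕_) (⨁-zero∷ n (f ∘ suc)))
                          (cong (_∷ (f zero ⊕ ⨁ n (f ∘ suc))) (addMod-identityˡ zero))

⨁-units : ∀ {r} {ks : Vec ℕ r} (x : G ks) → ⨁ r (λ t → unit t (coord x t)) ≡ x
⨁-units [] = refl
⨁-units {r = suc r} {k ∷ ks} (x ∷ xs) = begin
  (x′ ∷ 0G) ⊕ ⨁ r (λ t → zero ∷ unit t (coord xs t))   ≡⟨ cong ((x′ ∷ 0G) ⊕_) (⨁-zero∷ r (λ t → unit t (coord xs t))) ⟩
  addMod x′ zero ∷ (0G ⊕ ⨁ r (λ t → unit t (coord xs t))) ≡⟨ cong₂ _∷_ (trans (addMod-comm x′ zero) (addMod-identityˡ x′))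
                                                                       (trans (⊕-identityˡ _) (⨁-units xs)) ⟩
  x′ ∷ xs                                                ≡⟨ cong (_∷ xs) (toℕ-injective (trans (toℕ-fromℕ< _) (m<n⇒m%n≡m (toℕ<n x)))) ⟩
  x ∷ xs                                                 ∎
  where
  open ≡-Reasoning
  x′ : Fin (modulus k)
  x′ = fromℕ< (m%n<n (toℕ x) (modulus k))

-- Counting along bijections

card-unique : ∀ {A : Set} {m n} → A HasCard m → A HasCard n → m ≡ n
card-unique e f = ≤-antisym (injective⇒≤ (injective (↔-trans e (↔-sym f))))
                            (injective⇒≤ (injective (↔-trans f (↔-sym e))))
  where
  injective : ∀ {A B : Set} (e : A ↔ B) {x y} → Inverse.to e x ≡ Inverse.to e y → x ≡ y
  injective e {x} {y} eq = trans (sym (Inverse.strictlyInverseʳ e x))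
                                 (trans (cong (Inverse.from e) eq) (Inverse.strictlyInverseʳ e y))

Σ-Fin-suc : ∀ {n} (B : Fin (suc n) → Set) → Σ (Fin (suc n)) B ↔ (B zero ⊎ Σ (Fin n) (B ∘ suc))
Σ-Fin-suc B = mk↔ₛ′ split join split-join join-split
  where
  split : Σ _ B → _
  split (zero , b) = inj₁ b
  split (suc i , b) = inj₂ (i , b)
  join : _ → Σ _ B
  join (inj₁ b) = zero , b
  join (inj₂ (i , b)) = suc i , b
  split-join : ∀ y → split (join y) ≡ y
  split-join (inj₁ b) = refl
  split-join (inj₂ (i , b)) = refl
  join-split : ∀ x → join (split x) ≡ x
  join-split (zero , b) = refl
  join-split (suc i , b) = refl

Fin-∑↔Σ : ∀ n (g : Fin n → ℕ) → Fin (sum g) ↔ Σ (Fin n) (Fin ∘ g)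
Fin-∑↔Σ zero g = mk↔ₛ′ (λ ()) (λ { (() , _) }) (λ { (() , _) }) (λ ())
Fin-∑↔Σ (suc n) g = ↔-trans +↔⊎ (↔-trans (↔-refl ⊎-cong Fin-∑↔Σ n (g ∘ suc)) (↔-sym (Σ-Fin-suc (Fin ∘ g))))

Σ-card : ∀ {A : Set} {B : A → Set} {n} (e : A HasCard n) (f : A → ℕ)
  → (∀ a → B a HasCard f a) → Σ A B HasCard sum (f ∘ Inverse.to e)
Σ-card {n = n} e f cards = ↔-trans (Fin-∑↔Σ n (f ∘ Inverse.to e)) (Σ-↔ e (cards _))

Dec-card : ∀ {P : Set} → (∀ (x y : P) → x ≡ y) → (d : Dec P) → P HasCard 𝟙[ d ]
Dec-card irr (yes p) = mk↔ₛ′ (λ _ → p) (λ _ → zero) (irr p) (λ { zero → refl })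
Dec-card irr (no ¬p) = mk↔ₛ′ (λ ()) (⊥-elim ∘ ¬p) (⊥-elim ∘ ¬p) (λ ())

-- Walks labelled by G in a digraph with K out-arcs per vertex

module LabelledWalks {r} (ks : Vec ℕ r) {X : Set} (_≟X_ : DecidableEquality X)
  {K : ℕ} (next : X → Fin K → X) (label : X → G ks) where

  Weight : Set
  Weight = X → G ks → ℕ

  prefix : G ks → Weight → Weight
  prefix g F y h = F y (g ⊕ h)

  -- the sum of F (end vertex, sum of the labels met before it) over the K ^ L walks of length L from x
  walkSum : ℕ → X → Weight → ℕ
  walkSum zero x F = F x 0G
  walkSum (suc L) x F = sum λ i → walkSum L (next x i) (prefix (label x) F)

  walkSum-cong : ∀ L x {F F′ : Weight} → (∀ y h → F y h ≡ F′ y h) → walkSum L x F ≡ walkSum L x F′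
  walkSum-cong zero x F≗F′ = F≗F′ x 0G
  walkSum-cong (suc L) x F≗F′ = sum-cong-≗ λ i → walkSum-cong L (next x i) λ y h → F≗F′ y _

  walkSum-mono-≤ : ∀ L x {F F′ : Weight} → (∀ y h → F y h ≤ F′ y h) → walkSum L x F ≤ walkSum L x F′
  walkSum-mono-≤ zero x F≤F′ = F≤F′ x 0G
  walkSum-mono-≤ (suc L) x F≤F′ = ∑-mono-≤ λ i → walkSum-mono-≤ L (next x i) λ y h → F≤F′ y _

  walkSum-distrib-+ : ∀ L x (F F′ : Weight)
    → walkSum L x (λ y h → F y h + F′ y h) ≡ walkSum L x F + walkSum L x F′
  walkSum-distrib-+ zero x F F′ = refl
  walkSum-distrib-+ (suc L) x F F′ =
    trans (sum-cong-≗ λ i → walkSum-distrib-+ L (next x i) (prefix (label x) F) (prefix (label x) F′))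
          (∑-distrib-+ (λ i → walkSum L (next x i) (prefix (label x) F))
                       (λ i → walkSum L (next x i) (prefix (label x) F′)))

  *-distribˡ-walkSum : ∀ L x c (F : Weight) → c * walkSum L x F ≡ walkSum L x (λ y h → c * F y h)
  *-distribˡ-walkSum zero x c F = refl
  *-distribˡ-walkSum (suc L) x c F =
    trans (*-distribˡ-sum c (λ i → walkSum L (next x i) (prefix (label x) F)))
          (sum-cong-≗ λ i → *-distribˡ-walkSum L (next x i) c (prefix (label x) F))

  walkSum-const : ∀ L x c → walkSum L x (λ _ _ → c) ≡ K ^ L * c
  walkSum-const zero x c = sym (+-identityʳ c)
  walkSum-const (suc L) x c = begin
    sum (λ i → walkSum L (next x i) (λ _ _ → c))   ≡⟨ sum-cong-≗ (λ i → walkSum-const L (next x i) c) ⟩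
    sum {K} (λ _ → K ^ L * c)                       ≡⟨ ∑-const K (K ^ L * c) ⟩
    K * (K ^ L * c)                                 ≡⟨ *-assoc K (K ^ L) c ⟨
    K ^ suc L * c                                   ∎
    where open ≡-Reasoning

  walkSum-ΣG : ∀ L x (Φ : G ks → Weight)
    → walkSum L x (λ y h → ΣG ks (λ g → Φ g y h)) ≡ ΣG ks (λ g → walkSum L x (Φ g))
  walkSum-ΣG zero x Φ = refl
  walkSum-ΣG (suc L) x Φ =
    trans (sum-cong-≗ λ i → walkSum-ΣG L (next x i) (λ g → prefix (label x) (Φ g)))
          (sym (ΣG-∑-comm ks (λ g i → walkSum L (next x i) (prefix (label x) (Φ g)))))

  infixr 5 _∷ₚ_
  data Path : X → X → ℕ → Set where
    []ₚ  : ∀ {x} → Path x x 0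
    _∷ₚ_ : ∀ {x y n} (i : Fin K) → Path (next x i) y n → Path x y (suc n)

  labelSum : ∀ {x y n} → Path x y n → G ks
  labelSum []ₚ = 0G
  labelSum (_∷ₚ_ {x} i p) = label x ⊕ labelSum p

  _++ₚ_ : ∀ {x y w m n} → Path x y m → Path y w n → Path x w (m + n)
  []ₚ ++ₚ q = q
  (i ∷ₚ p) ++ₚ q = i ∷ₚ (p ++ₚ q)

  labelSum-++ₚ : ∀ {x y w m n} (p : Path x y m) (q : Path y w n) → labelSum (p ++ₚ q) ≡ labelSum p ⊕ labelSum q
  labelSum-++ₚ []ₚ q = sym (⊕-identityˡ (labelSum q))
  labelSum-++ₚ (_∷ₚ_ {x} i p) q =
    trans (cong (label x ⊕_) (labelSum-++ₚ p q)) (sym (⊕-assoc (label x) (labelSum p) (labelSum q)))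

  repeatₚ : ∀ {x n} k → Path x x n → Path x x (k * n)
  repeatₚ zero p = []ₚ
  repeatₚ (suc k) p = p ++ₚ repeatₚ k p

  castₚ : ∀ {x x′ y y′ m n} → x ≡ x′ → y ≡ y′ → m ≡ n → Path x y m → Path x′ y′ n
  castₚ refl refl refl p = p

  labelSum-castₚ : ∀ {x x′ y y′ m n} (ex : x ≡ x′) (ey : y ≡ y′) (en : m ≡ n) (p : Path x y m)
    → labelSum (castₚ ex ey en p) ≡ labelSum p
  labelSum-castₚ refl refl refl p = refl

  path? : ∀ n x y → Dec (Path x y n)
  path? zero x y with x ≟X y
  ... | yes refl = yes []ₚ
  ... | no x≢y = no λ { []ₚ → x≢y refl }
  path? (suc n) x y with any? (λ i → path? n (next x i) y)
  ... | yes (i , p) = yes (i ∷ₚ p)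
  ... | no ¬p = no λ { (i ∷ₚ p) → ¬p (i , p) }

  -- only up to double negation: the walks given by Condition 2 are selected by cases on an undecidable W
  Reach : X → X → ℕ → G ks → Set
  Reach x y n g = ¬ ¬ Σ (Path x y n) (λ p → labelSum p ≡ g)

  reach : ∀ {x y n} (p : Path x y n) → Reach x y n (labelSum p)
  reach p = ¬¬-pure (p , refl)

  reach-++ : ∀ {x y w m n g h} → Reach x y m g → Reach y w n h → Reach x w (m + n) (g ⊕ h)
  reach-++ reach₁ reach₂ = reach₁ >>= λ (p , p↦g) → reach₂ >>= λ (q , q↦h) →
    ¬¬-pure (p ++ₚ q , trans (labelSum-++ₚ p q) (cong₂ _⊕_ p↦g q↦h))

  reach-times : ∀ {x n g} → Reach x x n g → ∀ k → Reach x x (k * n) (times k g)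
  reach-times r zero = reach []ₚ
  reach-times r (suc k) = reach-++ r (reach-times r k)

  reach-⨁ : ∀ {x} m (ℓ : Fin m → ℕ) (f : Fin m → G ks) → (∀ i → Reach x x (ℓ i) (f i)) → Reach x x (sum ℓ) (⨁ m f)
  reach-⨁ zero ℓ f reaches = reach []ₚ
  reach-⨁ (suc m) ℓ f reaches = reach-++ (reaches zero) (reach-⨁ m (ℓ ∘ suc) (f ∘ suc) (reaches ∘ suc))

  reach-cast : ∀ {x y m n g h} → m ≡ n → g ≡ h → Reach x y m g → Reach x y n h
  reach-cast refl refl r = r

  path≤walkSum : ∀ {x z L} (p : Path x z L) (F : Weight) → F z (labelSum p) ≤ walkSum L x F
  path≤walkSum []ₚ F = ≤-refl
  path≤walkSum (_∷ₚ_ {x} {n = L} i p) F =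
    ≤-trans (path≤walkSum p (prefix (label x) F)) (term≤∑ (λ j → walkSum L (next x j) (prefix (label x) F)) i)

  point : X → G ks → Weight
  point z g y h = 𝟙[ y ≟X z ] * 𝟙[ g ≟G h ]

  path⇒point : ∀ {x z L} (p : Path x z L) → 1 ≤ walkSum L x (point z (labelSum p))
  path⇒point {x} {z} {L} p = subst (_≤ walkSum L x (point z (labelSum p)))
    (cong₂ _*_ (𝟙-yes refl (z ≟X z)) (𝟙-yes refl (labelSum p ≟G labelSum p)))
    (path≤walkSum p (point z (labelSum p)))

  -- Doeblin's condition for the chain of pairs (vertex, label sum)
  DoeblinAt : ℕ → X → Set
  DoeblinAt L z = ∀ x g → 1 ≤ walkSum L x (point z g)

  -- the conclusion is decidable, so double negation can be removed
  reach⇒DoeblinAt : ∀ L z → (∀ x g → Reach x z L g) → DoeblinAt L z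
  reach⇒DoeblinAt L z reaches x g = decidable-stable (1 ≤? walkSum L x (point z g))
    (¬¬-map (λ (p , p↦g) → subst (λ g → 1 ≤ walkSum L x (point z g)) p↦g (path⇒point p)) (reaches x g))

  ΣG≤walkSum : ∀ L z → DoeblinAt L z → ∀ x (F : Weight) → ΣG ks (F z) ≤ walkSum L x F
  ΣG≤walkSum L z doeblin x F = begin
    ΣG ks (F z)                                               ≡⟨ ΣG-cong ks (λ g → *-identityʳ (F z g)) ⟨
    ΣG ks (λ g → F z g * 1)                                   ≤⟨ ΣG-mono-≤ ks (λ g → *-monoʳ-≤ (F z g) (doeblin x g)) ⟩
    ΣG ks (λ g → F z g * walkSum L x (point z g))             ≡⟨ ΣG-cong ks (λ g → *-distribˡ-walkSum L x (F z g) (point z g)) ⟩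
    ΣG ks (λ g → walkSum L x (λ y h → F z g * point z g y h)) ≡⟨ walkSum-ΣG L x (λ g y h → F z g * point z g y h) ⟨
    walkSum L x (λ y h → ΣG ks (λ g → F z g * point z g y h)) ≤⟨ walkSum-mono-≤ L x collapse ⟩
    walkSum L x F                                             ∎
    where
    open ≤-Reasoning
    collapse : ∀ y h → ΣG ks (λ g → F z g * point z g y h) ≤ F y h
    collapse y h with y ≟X z
    ... | no _ = ≤-trans (≤-reflexive (trans (ΣG-cong ks (λ g → *-zeroʳ (F z g))) (trans (ΣG-const ks 0) (*-zeroʳ (order ks))))) z≤n
    ... | yes refl = ≤-reflexive (trans (ΣG-cong ks (λ g → rearrange (F y g) 𝟙[ g ≟G h ])) (ΣG-pick ks (F y) h))
      where
      rearrange : ∀ a b → a * (1 * b) ≡ b * a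
      rearrange a b = trans (cong (a *_) (*-identityˡ b)) (*-comm a b)

  walkSum-split : ∀ L x (F : Weight) c → (∀ y h → c ≤ F y h)
    → walkSum L x F ≡ walkSum L x (λ y h → F y h ∸ c) + K ^ L * c
  walkSum-split L x F c c≤F = begin
    walkSum L x F                                                ≡⟨ walkSum-cong L x (λ y h → sym (m∸n+n≡m (c≤F y h))) ⟩
    walkSum L x (λ y h → F y h ∸ c + c)                          ≡⟨ walkSum-distrib-+ L x (λ y h → F y h ∸ c) (λ _ _ → c) ⟩
    walkSum L x (λ y h → F y h ∸ c) + walkSum L x (λ _ _ → c)    ≡⟨ cong (walkSum L x (λ y h → F y h ∸ c) +_) (walkSum-const L x c) ⟩
    walkSum L x (λ y h → F y h ∸ c) + K ^ L * c                  ∎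
    where open ≡-Reasoning

  walkSum-complement : ∀ L x (F : Weight) c → (∀ y h → F y h ≤ c)
    → walkSum L x F + walkSum L x (λ y h → c ∸ F y h) ≡ K ^ L * c
  walkSum-complement L x F c F≤c = begin
    walkSum L x F + walkSum L x (λ y h → c ∸ F y h)   ≡⟨ walkSum-distrib-+ L x F (λ y h → c ∸ F y h) ⟨
    walkSum L x (λ y h → F y h + (c ∸ F y h))         ≡⟨ walkSum-cong L x (λ y h → m+[n∸m]≡n (F≤c y h)) ⟩
    walkSum L x (λ _ _ → c)                           ≡⟨ walkSum-const L x c ⟩
    K ^ L * c                                         ∎
    where open ≡-Reasoning

  -- Under Doeblin's condition, walkSum L contracts the oscillation of a weight by the factor ρ / K ^ L.
  module Contraction (L : ℕ) (z : X) (doeblin : DoeblinAt L z) where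

    ρ : ℕ
    ρ = K ^ L ∸ order ks

    |G|≤K^L : order ks ≤ K ^ L
    |G|≤K^L = begin
      order ks                   ≡⟨ *-identityʳ (order ks) ⟨
      order ks * 1               ≡⟨ ΣG-const ks 1 ⟨
      ΣG ks (λ _ → 1)            ≤⟨ ΣG≤walkSum L z doeblin z (λ _ _ → 1) ⟩
      walkSum L z (λ _ _ → 1)    ≡⟨ walkSum-const L z 1 ⟩
      K ^ L * 1                  ≡⟨ *-identityʳ (K ^ L) ⟩
      K ^ L                      ∎
      where open ≤-Reasoning

    K^L*c≡ρ*c+|G|*c : ∀ c → K ^ L * c ≡ ρ * c + order ks * c
    K^L*c≡ρ*c+|G|*c c = trans (cong (_* c) (sym (m∸n+n≡m |G|≤K^L))) (*-distribʳ-+ c ρ (order ks))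

    walkSum-lower : ∀ x (F : Weight) lo → (∀ y h → lo ≤ F y h) → ΣG ks (F z) + ρ * lo ≤ walkSum L x F
    walkSum-lower x F lo lo≤F = begin
      ΣG ks (F z) + ρ * lo                      ≡⟨ cong (_+ ρ * lo) (ΣG-split ks (F z) lo (lo≤F z)) ⟩
      A + order ks * lo + ρ * lo                ≡⟨ +-assoc A (order ks * lo) (ρ * lo) ⟩
      A + (order ks * lo + ρ * lo)              ≡⟨ cong (A +_) (trans (+-comm (order ks * lo) (ρ * lo)) (sym (K^L*c≡ρ*c+|G|*c lo))) ⟩
      A + K ^ L * lo                            ≤⟨ +-monoˡ-≤ (K ^ L * lo) (ΣG≤walkSum L z doeblin x (λ y h → F y h ∸ lo)) ⟩
      walkSum L x (λ y h → F y h ∸ lo) + K ^ L * lo   ≡⟨ walkSum-split L x F lo lo≤F ⟨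
      walkSum L x F                             ∎
      where
      open ≤-Reasoning
      A : ℕ
      A = ΣG ks (λ g → F z g ∸ lo)

    walkSum-upper : ∀ x (F : Weight) hi → (∀ y h → F y h ≤ hi) → walkSum L x F ≤ ΣG ks (F z) + ρ * hi
    walkSum-upper x F hi F≤hi = +-cancelʳ-≤ B (walkSum L x F) (ΣG ks (F z) + ρ * hi) (begin
      walkSum L x F + B                   ≡⟨ walkSum-complement L x F hi F≤hi ⟩
      K ^ L * hi                          ≡⟨ K^L*c≡ρ*c+|G|*c hi ⟩
      ρ * hi + order ks * hi              ≡⟨ cong (ρ * hi +_) (ΣG-complement ks (F z) hi (F≤hi z)) ⟨
      ρ * hi + (ΣG ks (F z) + A)          ≤⟨ +-monoʳ-≤ (ρ * hi) (+-monoʳ-≤ (ΣG ks (F z)) (ΣG≤walkSum L z doeblin x (λ y h → hi ∸ F y h))) ⟩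
      ρ * hi + (ΣG ks (F z) + B)          ≡⟨ rearrange (ρ * hi) (ΣG ks (F z)) B ⟩
      ΣG ks (F z) + ρ * hi + B            ∎)
      where
      open ≤-Reasoning
      A B : ℕ
      A = ΣG ks (λ g → hi ∸ F z g)
      B = walkSum L x (λ y h → hi ∸ F y h)
      rearrange : ∀ a b c → a + (b + c) ≡ b + a + c
      rearrange a b c = trans (sym (+-assoc a b c)) (cong (_+ c) (+-comm a b))

  module Counting (base : Weight) (T₀ : ℕ) (base-total : ∀ x → ΣG ks (base x) ≡ T₀) where

    count : ℕ → Weight
    count zero = base
    count (suc a) x g = sum λ i → count a (next x i) (g ⊖ label x)

    count-total : ∀ a x → ΣG ks (count a x) ≡ K ^ a * T₀
    count-total zero x = trans (base-total x) (sym (+-identityʳ T₀))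
    count-total (suc a) x = begin
      ΣG ks (λ g → sum (λ i → count a (next x i) (g ⊖ label x)))
        ≡⟨ ΣG-∑-comm ks (λ g i → count a (next x i) (g ⊖ label x)) ⟩
      sum (λ i → ΣG ks (λ g → count a (next x i) (g ⊖ label x)))
        ≡⟨ sum-cong-≗ (λ i → trans (ΣG-translate ks (count a (next x i)) (label x)) (count-total a (next x i))) ⟩
      sum {K} (λ _ → K ^ a * T₀)   ≡⟨ ∑-const K (K ^ a * T₀) ⟩
      K * (K ^ a * T₀)             ≡⟨ *-assoc K (K ^ a) T₀ ⟨
      K ^ suc a * T₀               ∎
      where open ≡-Reasoning

    count-split : ∀ L a x g → count (L + a) x g ≡ walkSum L x (λ y h → count a y (g ⊖ h))
    count-split zero a x g = cong (count a x) (sym (⊖-identityʳ g))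
    count-split (suc L) a x g = sum-cong-≗ λ i →
      trans (count-split L a (next x i) (g ⊖ label x))
            (walkSum-cong L (next x i) (λ y h → cong (count a y) (⊖-⊖ g (label x) h)))

    module _ (L : ℕ) (z : X) (doeblin : DoeblinAt L z) where
      open Contraction L z doeblin

      count-pinched : ∀ j a₀ → ∃ λ lo → ∀ x g
        → lo ≤ count (j * L + a₀) x g × count (j * L + a₀) x g ≤ lo + ρ ^ j * (K ^ a₀ * T₀)
      count-pinched zero a₀ = 0 , λ x g →
        z≤n , ≤-trans (term≤ΣG ks (count a₀ x) g) (≤-reflexive (trans (count-total a₀ x) (sym (+-identityʳ _))))
      count-pinched (suc j) a₀ with count-pinched j a₀
      ... | lo , pinch = K ^ a * T₀ + ρ * lo , λ x g →
        subst (λ c → K ^ a * T₀ + ρ * lo ≤ c × c ≤ K ^ a * T₀ + ρ * lo + ρ ^ suc j * T) (sym (unfold x g))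
              (lower x g , upper x g)
        where
        a T : ℕ
        a = j * L + a₀
        T = K ^ a₀ * T₀
        F : G ks → Weight
        F g y h = count a y (g ⊖ h)
        ΣF≡ : ∀ g → ΣG ks (F g z) ≡ K ^ a * T₀
        ΣF≡ g = trans (ΣG-reflect ks (count a z) g) (count-total a z)
        unfold : ∀ x g → count (suc j * L + a₀) x g ≡ walkSum L x (F g)
        unfold x g = trans (cong (λ b → count b x g) (+-assoc L (j * L) a₀)) (count-split L a x g)
        lower : ∀ x g → K ^ a * T₀ + ρ * lo ≤ walkSum L x (F g)
        lower x g = subst (λ t → t + ρ * lo ≤ walkSum L x (F g)) (ΣF≡ g)
                          (walkSum-lower x (F g) lo (λ y h → proj₁ (pinch y (g ⊖ h))))
        distribute : ∀ t → t + ρ * (lo + ρ ^ j * T) ≡ t + ρ * lo + ρ ^ suc j * T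
        distribute t = trans (cong (t +_) (*-distribˡ-+ ρ lo (ρ ^ j * T)))
                             (trans (sym (+-assoc t (ρ * lo) _)) (cong (t + ρ * lo +_) (sym (*-assoc ρ (ρ ^ j) T))))
        upper : ∀ x g → walkSum L x (F g) ≤ K ^ a * T₀ + ρ * lo + ρ ^ suc j * T
        upper x g = ≤-trans (walkSum-upper x (F g) (lo + ρ ^ j * T) (λ y h → proj₂ (pinch y (g ⊖ h))))
                            (≤-reflexive (trans (cong (_+ ρ * (lo + ρ ^ j * T)) (ΣF≡ g)) (distribute (K ^ a * T₀))))

      count-within : ∀ j a₀ x g →
        Within (order ks * (ρ ^ j * (K ^ a₀ * T₀))) (order ks * count (j * L + a₀) x g) (K ^ (j * L + a₀) * T₀)
      count-within j a₀ x g with count-pinched j a₀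
      ... | lo , pinch = above , below
        where
        a E : ℕ
        a = j * L + a₀
        E = ρ ^ j * (K ^ a₀ * T₀)
        mean-above : order ks * lo ≤ K ^ a * T₀
        mean-above = begin
          order ks * lo         ≡⟨ ΣG-const ks lo ⟨
          ΣG ks (λ _ → lo)      ≤⟨ ΣG-mono-≤ ks (λ h → proj₁ (pinch x h)) ⟩
          ΣG ks (count a x)     ≡⟨ count-total a x ⟩
          K ^ a * T₀            ∎
          where open ≤-Reasoning
        mean-below : K ^ a * T₀ ≤ order ks * lo + order ks * E
        mean-below = begin
          K ^ a * T₀                    ≡⟨ count-total a x ⟨
          ΣG ks (count a x)             ≤⟨ ΣG-mono-≤ ks (λ h → proj₂ (pinch x h)) ⟩
          ΣG ks (λ _ → lo + E)          ≡⟨ ΣG-const ks (lo + E) ⟩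
          order ks * (lo + E)           ≡⟨ *-distribˡ-+ (order ks) lo E ⟩
          order ks * lo + order ks * E  ∎
          where open ≤-Reasoning
        above : order ks * count a x g ≤ K ^ a * T₀ + order ks * E
        above = begin
          order ks * count a x g          ≤⟨ *-monoʳ-≤ (order ks) (proj₂ (pinch x g)) ⟩
          order ks * (lo + E)             ≡⟨ *-distribˡ-+ (order ks) lo E ⟩
          order ks * lo + order ks * E    ≤⟨ +-monoˡ-≤ (order ks * E) mean-above ⟩
          K ^ a * T₀ + order ks * E       ∎
          where open ≤-Reasoning
        below : K ^ a * T₀ ≤ order ks * count a x g + order ks * E
        below = ≤-trans mean-below (+-monoˡ-≤ (order ks * E) (*-monoʳ-≤ (order ks) (proj₁ (pinch x g))))

G-card : ∀ {r} (ks : Vec ℕ r) → G ks HasCard order ks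
G-card [] = mk↔ₛ′ (λ _ → []) (λ _ → zero) (λ { [] → refl }) (λ { zero → refl })
G-card (k ∷ ks) = ↔-trans *↔× (↔-trans (↔-refl ×-cong G-card ks) cons↔)
  where
  uncons : G (k ∷ ks) → Fin (modulus k) × G ks
  uncons (x ∷ xs) = x , xs
  cons↔ : (Fin (modulus k) × G ks) ↔ G (k ∷ ks)
  cons↔ = mk↔ₛ′ (λ (x , xs) → x ∷ xs) uncons (λ { (x ∷ xs) → refl }) (λ _ → refl)

Vec-card : ∀ {A : Set} {n} → A HasCard n → ∀ m → Vec A m HasCard (n ^ m)
Vec-card A-card zero = mk↔ₛ′ (λ _ → []) (λ _ → zero) (λ { [] → refl }) (λ { zero → refl })
Vec-card {A} A-card (suc m) = ↔-trans *↔× (↔-trans (A-card ×-cong Vec-card A-card m) cons↔)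
  where
  uncons : Vec A (suc m) → A × Vec A m
  uncons (x ∷ xs) = x , xs
  cons↔ : (A × Vec A m) ↔ Vec A (suc m)
  cons↔ = mk↔ₛ′ (λ (x , xs) → x ∷ xs) uncons (λ { (x ∷ xs) → refl }) (λ _ → refl)

-- Compositions as walks

sumG-++ : ∀ {r} {ks : Vec ℕ r} (l₁ l₂ : List (G ks)) → sumG (l₁ List.++ l₂) ≡ sumG l₁ ⊕ sumG l₂
sumG-++ List.[] l₂ = sym (⊕-identityˡ (sumG l₂))
sumG-++ (x List.∷ l₁) l₂ = trans (cong (x ⊕_) (sumG-++ l₁ l₂)) (sym (⊕-assoc x (sumG l₁) (sumG l₂)))

sumG-concat-∷ : ∀ {r} {ks : Vec ℕ r} {σ n} (v : Vec (G ks) σ) (vs : Vec (Vec (G ks) σ) n) (l : List (G ks))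
  → sumG (toList (concat (v ∷ vs)) List.++ l) ≡ sumV v ⊕ sumG (toList (concat vs) List.++ l)
sumG-concat-∷ v vs l = begin
  sumG (toList (v Data.Vec.++ concat vs) List.++ l)           ≡⟨ cong (λ l′ → sumG (l′ List.++ l)) (toList-++ v (concat vs)) ⟩
  sumG ((toList v List.++ toList (concat vs)) List.++ l)      ≡⟨ cong sumG (++-assoc (toList v) (toList (concat vs)) l) ⟩
  sumG (toList v List.++ (toList (concat vs) List.++ l))      ≡⟨ sumG-++ (toList v) _ ⟩
  sumV v ⊕ sumG (toList (concat vs) List.++ l)                ∎
  where open ≡-Reasoning

quotient-remainder-unique : ∀ σ q q′ r r′ → r < σ → r′ < σ → q * σ + r ≡ q′ * σ + r′ → q ≡ q′ × r ≡ r′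
quotient-remainder-unique σ zero zero r r′ _ _ eq = refl , eq
quotient-remainder-unique σ zero (suc q′) r r′ r<σ _ eq =
  ⊥-elim (<⇒≱ r<σ (subst (σ ≤_) (sym eq) (≤-trans (m≤m+n σ (q′ * σ)) (m≤m+n _ r′))))
quotient-remainder-unique σ (suc q) zero r r′ _ r′<σ eq =
  ⊥-elim (<⇒≱ r′<σ (subst (σ ≤_) eq (≤-trans (m≤m+n σ (q * σ)) (m≤m+n _ r))))
quotient-remainder-unique σ (suc q) (suc q′) r r′ r<σ r′<σ eq =
  let q≡q′ , r≡r′ = quotient-remainder-unique σ q q′ r r′ r<σ r′<σ
                      (+-cancelˡ-≡ σ _ _ (trans (sym (+-assoc σ (q * σ) r)) (trans eq (+-assoc σ (q′ * σ) r′))))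
  in cong suc q≡q′ , r≡r′

module Compositions {r} {ks : Vec ℕ r} {σ} (D : LRDigraph ks σ) (b : Fin σ) {K J : ℕ}
  (out-degree : ∀ u → Rec D u → Σ (V D) (ArcRR D u) HasCard K)
  (end-degree : ∀ u → Rec D u → Σ (Vec (G ks) (toℕ b)) (ArcRT D u b) HasCard J) where

  Recurrent : Set
  Recurrent = Σ (V D) (Rec D)

  _≟R_ : DecidableEquality Recurrent
  (u , ru) ≟R (v , rv) with ≡-dec _≟G_ u v
  ... | yes refl = yes (cong (u ,_) (T-irrelevant ru rv))
  ... | no u≢v = no (u≢v ∘ cong proj₁)

  next : Recurrent → Fin K → Recurrent
  next (u , ru) i = let v , _ , rv , _ = Inverse.to (out-degree u ru) i in v , rv

  label : Recurrent → G ks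
  label = sumV ∘ proj₁

  endSum : Recurrent → Fin J → G ks
  endSum (u , ru) i = sumV (proj₁ (Inverse.to (end-degree u ru) i))

  base : Recurrent → G ks → ℕ
  base x g = sum λ i → 𝟙[ label x ⊕ endSum x i ≟G g ]

  base-total : ∀ x → ΣG ks (base x) ≡ J
  base-total x = begin
    ΣG ks (base x)                                          ≡⟨ ΣG-∑-comm ks (λ g i → 𝟙[ label x ⊕ endSum x i ≟G g ]) ⟩
    sum (λ i → ΣG ks (λ g → 𝟙[ label x ⊕ endSum x i ≟G g ]))  ≡⟨ sum-cong-≗ (λ i → ΣG-single ks _ _ (off (label x ⊕ endSum x i))) ⟩
    sum (λ i → 𝟙[ label x ⊕ endSum x i ≟G label x ⊕ endSum x i ])  ≡⟨ sum-cong-≗ (λ i → 𝟙-yes refl (label x ⊕ endSum x i ≟G _)) ⟩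
    sum {J} (λ _ → 1)                                       ≡⟨ trans (∑-const J 1) (*-identityʳ J) ⟩
    J                                                       ∎
    where
    open ≡-Reasoning
    off : ∀ c g → g ≢ c → 𝟙[ c ≟G g ] ≡ 0
    off c g g≢c = 𝟙-no (g≢c ∘ sym) (c ≟G g)

  open LabelledWalks ks _≟R_ next label public
  open Counting base J base-total public

  Tail : ℕ → V D → G ks → Set
  Tail a v g = Σ (Vec (V D) a) λ xs → Chain D (v ∷ xs) × Σ (Vec (G ks) (toℕ b)) λ y →
    ArcRT D (last (v ∷ xs)) b y × sumG (toList (concat (v ∷ xs)) List.++ toList y) ≡ g

  Tail-zero↔ : ∀ v g → Tail zero v g ↔ Σ (Σ (Vec (G ks) (toℕ b)) (ArcRT D v b)) (λ p → sumV v ⊕ sumV (proj₁ p) ≡ g)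
  Tail-zero↔ v g = mk↔ₛ′ end-only with-end
    (λ { ((y , arc) , _) → cong (λ e → (y , arc) , e) (uip _ _) })
    (λ { ([] , rv , y , arc , _) → cong₂ (λ rv′ e → [] , rv′ , y , arc , e) (T-irrelevant _ rv) (uip _ _) })
    where
    sum-split : ∀ y → sumG (toList (concat (v ∷ [])) List.++ toList y) ≡ sumV v ⊕ sumV y
    sum-split y = sumG-concat-∷ v [] (toList y)
    end-only : Tail zero v g → Σ (Σ (Vec (G ks) (toℕ b)) (ArcRT D v b)) (λ p → sumV v ⊕ sumV (proj₁ p) ≡ g)
    end-only ([] , _ , y , arc , sum≡g) = (y , arc) , trans (sym (sum-split y)) sum≡g
    with-end : Σ (Σ (Vec (G ks) (toℕ b)) (ArcRT D v b)) (λ p → sumV v ⊕ sumV (proj₁ p) ≡ g) → Tail zero v g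
    with-end ((y , arc) , sum≡g) = [] , proj₁ arc , y , arc , trans (sum-split y) sum≡g

  Tail-suc↔ : ∀ a v g → Tail (suc a) v g ↔ Σ (Σ (V D) (ArcRR D v)) (λ p → Tail a (proj₁ p) (g ⊖ sumV v))
  Tail-suc↔ a v g = mk↔ₛ′ peel attach
    (λ { ((v′ , arc) , xs , ch , y , end , _) → cong (λ e → (v′ , arc) , xs , ch , y , end , e) (uip _ _) })
    (λ { (v′ ∷ xs , ch , y , end , _) → cong (λ e → v′ ∷ xs , ch , y , end , e) (uip _ _) })
    where
    sum-split : ∀ v′ (xs : Vec (V D) a) (y : Vec (G ks) (toℕ b))
      → sumG (toList (concat (v ∷ v′ ∷ xs)) List.++ toList y) ≡ sumV v ⊕ sumG (toList (concat (v′ ∷ xs)) List.++ toList y)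
    sum-split v′ xs y = sumG-concat-∷ v (v′ ∷ xs) (toList y)
    peel : Tail (suc a) v g → Σ (Σ (V D) (ArcRR D v)) (λ p → Tail a (proj₁ p) (g ⊖ sumV v))
    peel (v′ ∷ xs , (arc , ch) , y , end , sum≡g) =
      (v′ , arc) , xs , ch , y , end , ⊖-unique (sumV v) _ g (trans (sym (sum-split v′ xs y)) sum≡g)
    attach : Σ (Σ (V D) (ArcRR D v)) (λ p → Tail a (proj₁ p) (g ⊖ sumV v)) → Tail (suc a) v g
    attach ((v′ , arc) , xs , ch , y , end , sum≡g) =
      v′ ∷ xs , (arc , ch) , y , end , trans (sum-split v′ xs y) (trans (cong (sumV v ⊕_) sum≡g) (⊕-⊖ (sumV v) g))

  Tail-card : ∀ a v (rv : Rec D v) g → Tail a v g HasCard count a (v , rv) g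
  Tail-card zero v rv g = ↔-trans
    (Σ-card (end-degree v rv) (λ p → 𝟙[ sumV v ⊕ sumV (proj₁ p) ≟G g ]) (λ p → Dec-card uip (_ ≟G g)))
    (↔-sym (Tail-zero↔ v g))
  Tail-card (suc a) v rv g = ↔-trans
    (Σ-card (out-degree v rv) (λ p → count a (proj₁ p , proj₁ (proj₂ (proj₂ p))) (g ⊖ sumV v))
            (λ p → Tail-card a (proj₁ p) (proj₁ (proj₂ (proj₂ p))) (g ⊖ sumV v)))
    (↔-sym (Tail-suc↔ a v g))

  length-composition : ∀ {k} {j : Fin σ} (xs : Vec (V D) (suc k)) (y : Vec (G ks) (toℕ j))
    → length (toList (concat xs) List.++ toList y) ≡ suc k * σ + toℕ j
  length-composition xs y =
    trans (length-++ (toList (concat xs))) (cong₂ _+_ (length-toList (concat xs)) (length-toList y))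

  module _ (a : ℕ) (s : G ks) where

    StartAndTail : Set
    StartAndTail = Σ (Σ (V D) (ArcS D)) (λ p → Tail a (proj₁ p) s)

    shape : ∀ {k} {j : Fin σ} (xs : Vec (V D) (suc k)) (y : Vec (G ks) (toℕ j))
      → length (toList (concat xs) List.++ toList y) ≡ suc a * σ + toℕ b → k ≡ a × j ≡ b
    shape {k} {j} xs y len =
      let 1+k≡1+a , j≡b = quotient-remainder-unique σ (suc k) (suc a) (toℕ j) (toℕ b) (toℕ<n j) (toℕ<n b)
                             (trans (sym (length-composition xs y)) len)
      in suc-injective 1+k≡1+a , toℕ-injective j≡b

    split-walk : ∀ {k j} → k ≡ a → j ≡ b → (v : V D) (xs : Vec (V D) k) (y : Vec (G ks) (toℕ j))
      → ArcS D v → Chain D (v ∷ xs) → ArcRT D (last (v ∷ xs)) j y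
      → sumG (toList (concat (v ∷ xs)) List.++ toList y) ≡ s → StartAndTail
    split-walk refl refl v xs y start ch end sum≡s = (v , start) , xs , ch , y , end , sum≡s

    split-walk-refl : ∀ (p : a ≡ a) (q : b ≡ b) v xs y start ch end sum≡s
      → split-walk p q v xs y start ch end sum≡s ≡ ((v , start) , xs , ch , y , end , sum≡s)
    split-walk-refl refl refl v xs y start ch end sum≡s = refl

    split-composition : MComp D (suc a * σ + toℕ b) s → StartAndTail
    split-composition (_ , (record { xs = v ∷ xs ; y = y ; startArc = start ; chain = ch ; endArc = end } , refl) , len , sum≡s) =
      split-walk (proj₁ (shape (v ∷ xs) y len)) (proj₂ (shape (v ∷ xs) y len)) v xs y start ch end sum≡s

    join-composition : StartAndTail → MComp D (suc a * σ + toℕ b) s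
    join-composition ((v , start) , xs , ch , y , end , sum≡s) =
      _ , (record { xs = v ∷ xs ; y = y ; startArc = start ; chain = ch ; endArc = end } , refl)
        , length-composition (v ∷ xs) y , sum≡s

    MComp↔StartAndTail : MComp D (suc a * σ + toℕ b) s ↔ StartAndTail
    MComp↔StartAndTail = mk↔ₛ′ split-composition join-composition split-join join-split
      where
      split-join : ∀ t → split-composition (join-composition t) ≡ t
      split-join ((v , start) , xs , ch , y , end , sum≡s) = split-walk-refl _ _ v xs y start ch end sum≡s
      join-split : ∀ m → join-composition (split-composition m) ≡ m
      join-split (_ , (record { xs = v ∷ xs ; y = y ; startArc = start ; chain = ch ; endArc = end } , refl) , len , sum≡s)
        with shape (v ∷ xs) y len
      ... | refl , refl = trans
        (cong join-composition (split-walk-refl (proj₁ (shape (v ∷ xs) y len)) (proj₂ (shape (v ∷ xs) y len)) v xs y start ch end sum≡s))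
        (cong (λ len′ → _ , (_ , refl) , len′ , sum≡s) (uip _ len))

  initial : ∀ {H} → Σ (V D) (ArcS D) HasCard H → Fin H → Recurrent
  initial e i = let v , rv , _ = Inverse.to e i in v , rv

  MComp-card : ∀ a s {H} (start-degree : Σ (V D) (ArcS D) HasCard H)
    → MComp D (suc a * σ + toℕ b) s HasCard sum (λ i → count a (initial start-degree i) s)
  MComp-card a s start-degree = ↔-trans
    (Σ-card start-degree (λ p → count a (proj₁ p , proj₁ (proj₂ p)) s) (λ p → Tail-card a (proj₁ p) (proj₁ (proj₂ p)) s))
    (↔-sym (MComp↔StartAndTail a s))

  module _ (L : ℕ) (z : Recurrent) (doeblin : DoeblinAt L z) where
    open Contraction L z doeblin using (ρ)

    MComp-within : ∀ j r₀ s {H} (start-degree : Σ (V D) (ArcS D) HasCard H) n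
      → MComp D (suc (j * L + r₀) * σ + toℕ b) s HasCard n
      → Within (H * (order ks * (ρ ^ j * (K ^ r₀ * J)))) (n * order ks) (H * J * K ^ (j * L + r₀))
    MComp-within j r₀ s {H} start-degree n n-card = Within-resp
      (∑-const H (order ks * (ρ ^ j * (K ^ r₀ * J))))
      (begin
        sum (λ i → order ks * c i)   ≡⟨ *-distribˡ-sum (order ks) c ⟨
        order ks * sum c             ≡⟨ *-comm (order ks) (sum c) ⟩
        sum c * order ks             ≡⟨ cong (_* order ks) (card-unique (MComp-card a s start-degree) n-card) ⟩
        n * order ks                 ∎)
      (trans (∑-const H (K ^ a * J)) (trans (cong (H *_) (*-comm (K ^ a) J)) (sym (*-assoc H J (K ^ a)))))
      (Within-∑ _ (λ i → order ks * c i) _ (λ i → count-within L z doeblin j r₀ (initial start-degree i) s))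
      where
      open ≡-Reasoning
      a : ℕ
      a = j * L + r₀
      c : Fin H → ℕ
      c i = count a (initial start-degree i) s

  arc-index : ∀ {u v} (ru : Rec D u) (arc : ArcRR D u v) → Σ (Fin K) λ i → next (u , ru) i ≡ (v , proj₁ (proj₂ arc))
  arc-index {u} {v} ru arc = Inverse.from (out-degree u ru) (v , arc) ,
    cong (λ (v′ , _ , rv′ , _) → v′ , rv′) (Inverse.strictlyInverseˡ (out-degree u ru) (v , arc))

  chain⇒path : ∀ n (w : Vec (V D) (suc n)) → Chain D w → (rh : Rec D (head w)) (rl : Rec D (last w))
    → Path (head w , rh) (last w , rl) n
  chain⇒path zero (x ∷ []) _ rh rl = castₚ refl (cong (x ,_) (T-irrelevant rh rl)) refl []ₚ
  chain⇒path (suc n) (x ∷ y ∷ w) (arc , ch) rh rl =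
    let i , next≡ = arc-index rh arc in
    i ∷ₚ castₚ (sym next≡) refl refl (chain⇒path n (y ∷ w) ch (proj₁ (proj₂ arc)) rl)

  recurrent-≡ : ∀ {v v′} → v ≡ v′ → (rv : Rec D v) (rv′ : Rec D v′) → _≡_ {A = Recurrent} (v , rv) (v′ , rv′)
  recurrent-≡ {v} refl rv rv′ = cong (v ,_) (T-irrelevant rv rv′)

  walk⇒path : ∀ {u v n w} → WalkR D u v n w → (ru : Rec D u) (rv : Rec D v) → Path (u , ru) (v , rv) n
  walk⇒path {n = n} {w} (head≡u , last≡v , ch) ru rv = castₚ (recurrent-≡ head≡u _ ru) (recurrent-≡ last≡v _ rv) refl
    (chain⇒path n w ch (subst (Rec D) (sym head≡u) ru) (subst (Rec D) (sym last≡v) rv))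

  connect : StronglyConnected D → ∀ x y → ∃ λ n → Path x y n
  connect strong (u , ru) (v , rv) = let n , _ , walk = strong u v ru rv in n , walk⇒path walk ru rv

  sumVs : ∀ {m} → Vec (V D) m → G ks
  sumVs [] = 0G
  sumVs (x ∷ w) = sumV x ⊕ sumVs w

  labelSum-chain : ∀ {m} x (w : Vec (V D) m) v ch rh rl
    → labelSum (chain⇒path (suc m) (x ∷ (w ∷ʳ v)) ch rh rl) ≡ sumV x ⊕ sumVs w
  labelSum-chain x [] v (arc , ch) rh rl = cong (sumV x ⊕_) (trans
    (labelSum-castₚ (sym (proj₂ (arc-index rh arc))) refl refl (chain⇒path 0 (v ∷ []) ch (proj₁ (proj₂ arc)) rl))
    (labelSum-castₚ refl (cong (v ,_) (T-irrelevant (proj₁ (proj₂ arc)) rl)) refl []ₚ))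
  labelSum-chain x (y ∷ w) v (arc , ch) rh rl = cong (sumV x ⊕_) (trans
    (labelSum-castₚ (sym (proj₂ (arc-index rh arc))) refl refl (chain⇒path _ (y ∷ (w ∷ʳ v)) ch (proj₁ (proj₂ arc)) rl))
    (labelSum-chain y w v ch (proj₁ (proj₂ arc)) rl))

  chain-head-rec : ∀ {n} x (w : Vec (V D) n) → Chain D (x ∷ w) → Rec D x
  chain-head-rec x [] rx = rx
  chain-head-rec x (y ∷ w) (arc , _) = proj₁ arc


  cycle⇒path : ∀ {n} v (vs : Vec (V D) n) → IsCycle D (v ∷ vs) → Σ (Rec D v) λ rv → Path (v , rv) (v , rv) (suc n)
  cycle⇒path {n} v vs (ch , _) = rv , castₚ refl (recurrent-≡ (last-∷ʳ v (v ∷ vs)) rl rv) refl (chain⇒path (suc n) (v ∷ (vs ∷ʳ v)) ch rv rl)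
    where
    rv : Rec D v
    rv = chain-head-rec v (vs ∷ʳ v) ch
    rl : Rec D (last (v ∷ (vs ∷ʳ v)))
    rl = subst (Rec D) (sym (last-∷ʳ v (v ∷ vs))) rv

  coord-sumVs : ∀ {m} (w : Vec (V D) m) i → coord (sumVs w) i ≡ Nval D i w % modulusAt ks i
  coord-sumVs [] i = coord-0G ks i
  coord-sumVs (x ∷ w) i = begin
    coord (sumV x ⊕ sumVs w) i                            ≡⟨ coord-⊕ (sumV x) (sumVs w) i ⟩
    (coord (sumV x) i + coord (sumVs w) i) % k            ≡⟨ cong₂ (λ a c → (a + c) % k) (coord-sumV x i) (coord-sumVs w i) ⟩
    (size x i % k + Nval D i w % k) % k                   ≡⟨ %-distribˡ-+ (size x i) (Nval D i w) k ⟨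
    (size x i + Nval D i w) % k                           ∎
    where
    open ≡-Reasoning
    k : ℕ
    k = modulusAt ks i

  Nval-as-sum : ∀ {m} (w : Vec (V D) m) i → Nval D i w ≡ sum (λ j → size (lookup w j) i)
  Nval-as-sum [] i = refl
  Nval-as-sum (x ∷ w) i = cong (size x i +_) (Nval-as-sum w i)

  labelSum-walk⇒path : ∀ {m u v} (w : Vec (V D) m) (walk : WalkR D u v (suc m) (u ∷ (w ∷ʳ v))) ru rv
    → labelSum (walk⇒path {n = suc m} {u ∷ (w ∷ʳ v)} walk ru rv) ≡ sumV u ⊕ sumVs w
  labelSum-walk⇒path {m} {u} {v} w (head≡u , last≡v , ch) ru rv = trans
    (labelSum-castₚ (recurrent-≡ head≡u _ ru) (recurrent-≡ last≡v _ rv) refl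
      (chain⇒path (suc m) (u ∷ (w ∷ʳ v)) ch (subst (Rec D) (sym head≡u) ru) (subst (Rec D) (sym last≡v) rv)))
    (labelSum-chain u w v ch _ _)

  #V : ℕ
  #V = order ks ^ σ

  V-card : V D HasCard #V
  V-card = Vec-card (G-card ks) σ

  -- Aperiodicity

  module Aperiodicity (strong : StronglyConnected D) (gcd-one : CycleGcdOne D) (z : Recurrent) where

    round-trip : Recurrent → ℕ
    round-trip x = proj₁ (connect strong z x) + proj₁ (connect strong x z)

    round-trip? : V D → ℕ
    round-trip? v with T? (LRDigraph.isR D v)
    ... | yes rv = round-trip (v , rv)
    ... | no _ = 0

    round-trips : ℕ
    round-trips = sum (λ i → round-trip? (Inverse.to V-card i))

    round-trip≤ : ∀ x → round-trip x ≤ round-trips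
    round-trip≤ (v , rv) = ≤-trans (≤-round-trip? v rv)
      (subst (λ v′ → round-trip? v′ ≤ round-trips) (Inverse.strictlyInverseˡ V-card v) (term≤∑ _ (Inverse.from V-card v)))
      where
      ≤-round-trip? : ∀ v (rv : Rec D v) → round-trip (v , rv) ≤ round-trip? v
      ≤-round-trip? v rv with T? (LRDigraph.isR D v)
      ... | yes rv′ = ≤-reflexive (cong round-trip (recurrent-≡ refl rv rv′))
      ... | no ¬rv = ⊥-elim (¬rv rv)

    cycle-length≤#V : ∀ {n} (vs : Vec (V D) (suc n)) → IsCycle D vs → suc n ≤ #V
    cycle-length≤#V vs (_ , distinct) = injective⇒≤ λ {i} {j} eq → distinct i j (begin
      lookup vs i                                           ≡⟨ Inverse.strictlyInverseˡ V-card _ ⟨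
      Inverse.to V-card (Inverse.from V-card (lookup vs i)) ≡⟨ cong (Inverse.to V-card) eq ⟩
      Inverse.to V-card (Inverse.from V-card (lookup vs j)) ≡⟨ Inverse.strictlyInverseˡ V-card _ ⟩
      lookup vs j                                           ∎)
      where open ≡-Reasoning

    record ClosedPair (g : ℕ) : Set where
      field
        short : ℕ
        short-path : Path z z short
        long-path : Path z z (short + g)

    closed-pair-gcd : ∀ {g n} → ClosedPair g → Path z z n → ∃ λ d → GCD g n d × ClosedPair d
    closed-pair-gcd {g} {n} pair cyc with Bézout.lemma g n
    ... | Bézout.result d gcd (Bézout.+- x y d+yn≡xg) = d , gcd , record
      { short = x * short + y * n
      ; short-path = repeatₚ x short-path ++ₚ repeatₚ y cyc
      ; long-path = castₚ refl refl (gap x y short g n d d+yn≡xg) (repeatₚ x long-path)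
      }
      where
      open ClosedPair pair
      gap : ∀ x y q g n d → d + y * n ≡ x * g → x * (q + g) ≡ x * q + y * n + d
      gap x y q g n d eq = trans (cong (x *_) (+-comm q g)) (trans (*-distribˡ-+ x g q)
        (trans (cong (_+ x * q) (sym eq)) (rearrange d (y * n) (x * q))))
        where
        rearrange : ∀ a b c → a + b + c ≡ c + b + a
        rearrange = solve-∀
    ... | Bézout.result d gcd (Bézout.-+ x y d+xg≡yn) = d , gcd , record
      { short = x * (short + g)
      ; short-path = repeatₚ x long-path
      ; long-path = castₚ refl refl (gap x y short g n d d+xg≡yn) (repeatₚ x short-path ++ₚ repeatₚ y cyc)
      }
      where
      open ClosedPair pair
      gap : ∀ x y q g n d → d + x * g ≡ y * n → x * q + y * n ≡ x * (q + g) + d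
      gap x y q g n d eq = trans (cong (x * q +_) (sym eq)) (trans (rearrange (x * q) d (x * g))
        (cong (_+ d) (sym (*-distribˡ-+ x q g))))
        where
        rearrange : ∀ a b c → a + (b + c) ≡ a + c + b
        rearrange = solve-∀

    gcd-below : ∀ n₀ → ∃ λ g → ClosedPair g × (∀ n → n < n₀ → Path z z n → g ∣ n)
    gcd-below zero = 0 , record { short = 0 ; short-path = []ₚ ; long-path = []ₚ } , λ _ ()
    gcd-below (suc n₀) with gcd-below n₀ | path? n₀ z z
    ... | g , pair , g∣ | no ¬cyc = g , pair , λ n n<1+n₀ cyc → case m<1+n⇒m<n∨m≡n n<1+n₀ of λ where
      (inj₁ n<n₀) → g∣ n n<n₀ cyc
      (inj₂ refl) → ⊥-elim (¬cyc cyc)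
    ... | g , pair , g∣ | yes cyc₀ with closed-pair-gcd pair cyc₀
    ...   | d , gcd , pair′ = d , pair′ , λ n n<1+n₀ cyc → case m<1+n⇒m<n∨m≡n n<1+n₀ of λ where
      (inj₁ n<n₀) → ∣-trans (proj₁ (GCD.commonDivisor gcd)) (g∣ n n<n₀ cyc)
      (inj₂ refl) → proj₂ (GCD.commonDivisor gcd)

    bound : ℕ
    bound = round-trips + #V

    -- a cycle through v gives closed walks z → v → z below the bound, one with and one without the cycle
    gcd-divides-cycles : let g , _ = gcd-below (suc bound) in ∀ n (vs : Vec (V D) (suc n)) → IsCycle D vs → g ∣ suc n
    gcd-divides-cycles n (v ∷ vs) cycle = ∣m+n∣m⇒∣n (g∣ _ long<bound with-cycle) (g∣ _ short<bound without-cycle)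
      where
      g∣ : ∀ m → m < suc bound → Path z z m → proj₁ (gcd-below (suc bound)) ∣ m
      g∣ = proj₂ (proj₂ (gcd-below (suc bound)))
      rv-cyc : Σ (Rec D v) λ rv → Path (v , rv) (v , rv) (suc n)
      rv-cyc = cycle⇒path v vs cycle
      x : Recurrent
      x = v , proj₁ rv-cyc
      a c : ℕ
      a = proj₁ (connect strong z x)
      c = proj₁ (connect strong x z)
      without-cycle : Path z z (a + c)
      without-cycle = proj₂ (connect strong z x) ++ₚ proj₂ (connect strong x z)
      with-cycle : Path z z (a + c + suc n)
      with-cycle = castₚ refl refl (trans (cong (a +_) (+-comm (suc n) c)) (sym (+-assoc a c (suc n))))
        (proj₂ (connect strong z x) ++ₚ (proj₂ rv-cyc ++ₚ proj₂ (connect strong x z)))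
      short<bound : a + c < suc bound
      short<bound = s≤s (≤-trans (round-trip≤ x) (m≤m+n _ #V))
      long<bound : a + c + suc n < suc bound
      long<bound = s≤s (+-mono-≤ (round-trip≤ x) (cycle-length≤#V (v ∷ vs) cycle))

    closed-pair-one : ClosedPair 1
    closed-pair-one with gcd-below (suc bound) | gcd-divides-cycles
    ... | g , pair , _ | g∣cycles with ∣1⇒≡1 (gcd-one g g∣cycles)
    ... | refl = pair

    -- with closed walks of lengths q and q + 1, every n ≥ q² is (t ∸ s) * q + s * (q + 1) for n = t * q + s
    closed-walks-of-length : ∃ λ N → ∀ n → N ≤ n → Path z z n
    closed-walks-of-length with closed-pair-one
    ... | record { short = zero ; long-path = step } = 0 , λ n _ → castₚ refl refl (*-identityʳ n) (repeatₚ n step)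
    ... | record { short = suc q′ ; short-path = p ; long-path = p+1 } = q * q , every
      where
      q : ℕ
      q = suc q′
      every : ∀ n → q * q ≤ n → Path z z n
      every n q²≤n = castₚ refl refl split (repeatₚ (t ∸ s) p ++ₚ repeatₚ s p+1)
        where
        s t : ℕ
        s = n % q
        t = n / q
        s≤t : s ≤ t
        s≤t = ≤-trans (<⇒≤ (m%n<n n q)) (subst (_≤ t) (m*n/n≡m q q) (/-monoˡ-≤ q q²≤n))
        distribute : ∀ u s q → u * q + s * (q + 1) ≡ s + (u + s) * q
        distribute = solve-∀
        split : (t ∸ s) * q + s * (q + 1) ≡ n
        split = begin
          (t ∸ s) * q + s * (q + 1)   ≡⟨ distribute (t ∸ s) s q ⟩
          s + (t ∸ s + s) * q         ≡⟨ cong (λ u → s + u * q) (m∸n+n≡m s≤t) ⟩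
          s + t * q                   ≡⟨ m≡m%n+[m/n]*n n q ⟨
          n                           ∎
          where open ≡-Reasoning

  -- Shifting the label sum along one coordinate

  module UnitShifts (strong : StronglyConnected D) (z : Recurrent) (t : Fin r)
    {n} {u v : V D} {W : Vec (V D) n → Set} (ru : Rec D u) (rv : Rec D v)
    (walks : ∀ w → W w → WalkR D u v (suc n) (u ∷ (w ∷ʳ v)))
    (w₀ : Vec (V D) n) (Ww₀ : W w₀) (φ : Fin n → Fin r → ℕ)
    (fixed : ∀ w → W w → ∀ j i → (i ≡ t → ⊥) → size (lookup w j) i ≡ φ j i)
    (coprime : ∀ d → (∀ w w′ → W w → W w′ → d ℤD.∣ (ℤ.+ Nval D t w ℤ.- ℤ.+ Nval D t w′)) → d ℤD.∣ ℤ.+ 1) where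

    k′ : ℕ
    k′ = suc (lookup ks t)

    N : Vec (V D) n → ℕ
    N = Nval D t

    -- congruent to N w ∸ N w₀ modulo k′ + 1 = modulusAt ks t
    R : Vec (V D) n → ℕ
    R w = N w + k′ * N w₀

    unitₜ : ℕ → G ks
    unitₜ = unit t

    π : ∀ w → W w → Path (u , ru) (v , rv) (suc n)
    π w Ww = walk⇒path {n = suc n} {u ∷ (w ∷ʳ v)} (walks w Ww) ru rv

    coord-label : ∀ (w : Vec (V D) n) i → coord (sumV u ⊕ sumVs w) i ≡ (coord (sumV u) i + Nval D i w) % modulusAt ks i
    coord-label w i = trans (coord-⊕ (sumV u) (sumVs w) i)
      (trans (cong (λ c → (coord (sumV u) i + c) % modulusAt ks i) (coord-sumVs w i))
             ([m+n%d]%d≡[m+n]%d (coord (sumV u) i) (Nval D i w) (modulusAt ks i)))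

    Nval-fixed : ∀ w → W w → ∀ i → i ≢ t → Nval D i w ≡ Nval D i w₀
    Nval-fixed w Ww i i≢t = begin
      Nval D i w                          ≡⟨ Nval-as-sum w i ⟩
      sum (λ j → size (lookup w j) i)     ≡⟨ sum-cong-≗ (λ j → trans (fixed w Ww j i i≢t) (sym (fixed w₀ Ww₀ j i i≢t))) ⟩
      sum (λ j → size (lookup w₀ j) i)    ≡⟨ Nval-as-sum w₀ i ⟨
      Nval D i w₀                         ∎
      where open ≡-Reasoning

    label-shift : ∀ w → W w → sumV u ⊕ sumVs w ≡ (sumV u ⊕ sumVs w₀) ⊕ unitₜ (R w)
    label-shift w Ww = coord-ext-at t at-t off-t
      where
      X₀ : G ks
      X₀ = sumV u ⊕ sumVs w₀
      k cu : ℕ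
      k = modulusAt ks t
      cu = coord (sumV u) t
      rearrange : ∀ c a a₀ k′ → c + a + a₀ * suc k′ ≡ c + a₀ + (a + k′ * a₀)
      rearrange = solve-∀
      at-t : coord (sumV u ⊕ sumVs w) t ≡ coord (X₀ ⊕ unitₜ (R w)) t
      at-t = begin
        coord (sumV u ⊕ sumVs w) t                ≡⟨ coord-label w t ⟩
        (cu + N w) % k                            ≡⟨ [m+kn]%n≡m%n (cu + N w) (N w₀) k ⟨
        (cu + N w + N w₀ * k) % k                 ≡⟨ cong (_% k) (rearrange cu (N w) (N w₀) k′) ⟩
        (cu + N w₀ + R w) % k                     ≡⟨ [m%d+n]%d≡[m+n]%d (cu + N w₀) (R w) k ⟨
        ((cu + N w₀) % k + R w) % k               ≡⟨ [m+n%d]%d≡[m+n]%d ((cu + N w₀) % k) (R w) k ⟨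
        ((cu + N w₀) % k + R w % k) % k           ≡⟨ cong₂ (λ a c → (a + c) % k) (coord-label w₀ t) (coord-unit-≡ ks t (R w)) ⟨
        (coord X₀ t + coord (unitₜ (R w)) t) % k  ≡⟨ coord-⊕ X₀ (unitₜ (R w)) t ⟨
        coord (X₀ ⊕ unitₜ (R w)) t                ∎
        where open ≡-Reasoning
      off-t : ∀ i → i ≢ t → coord (sumV u ⊕ sumVs w) i ≡ coord (X₀ ⊕ unitₜ (R w)) i
      off-t i i≢t = begin
        coord (sumV u ⊕ sumVs w) i                              ≡⟨ coord-label w i ⟩
        (coord (sumV u) i + Nval D i w) % kᵢ                    ≡⟨ cong (λ a → (coord (sumV u) i + a) % kᵢ) (Nval-fixed w Ww i i≢t) ⟩
        (coord (sumV u) i + Nval D i w₀) % kᵢ                   ≡⟨ coord-label w₀ i ⟨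
        coord X₀ i                                              ≡⟨ m<n⇒m%n≡m (coord< X₀ i) ⟨
        coord X₀ i % kᵢ                                         ≡⟨ cong (_% kᵢ) (+-identityʳ (coord X₀ i)) ⟨
        (coord X₀ i + 0) % kᵢ                                   ≡⟨ cong (λ a → (coord X₀ i + a) % kᵢ) (coord-unit-≢ ks t (R w) i i≢t) ⟨
        (coord X₀ i + coord (unitₜ (R w)) i) % kᵢ               ≡⟨ coord-⊕ X₀ (unitₜ (R w)) i ⟨
        coord (X₀ ⊕ unitₜ (R w)) i                              ∎
        where
        open ≡-Reasoning
        kᵢ : ℕ
        kᵢ = modulusAt ks i

    to-u : ∃ λ a → Path z (u , ru) a
    to-u = connect strong z (u , ru)

    from-v : ∃ λ a → Path (v , rv) z a
    from-v = connect strong (v , rv) z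

    ℓ : ℕ
    ℓ = proj₁ to-u + (suc n + proj₁ from-v)

    closed : ∀ w → W w → Path z z ℓ
    closed w Ww = proj₂ to-u ++ₚ (π w Ww ++ₚ proj₂ from-v)

    labelSum-closed : ∀ w Ww → labelSum (closed w Ww) ≡ labelSum (proj₂ to-u) ⊕ ((sumV u ⊕ sumVs w) ⊕ labelSum (proj₂ from-v))
    labelSum-closed w Ww = trans (labelSum-++ₚ (proj₂ to-u) _) (cong (labelSum (proj₂ to-u) ⊕_)
      (trans (labelSum-++ₚ (π w Ww) (proj₂ from-v)) (cong (_⊕ labelSum (proj₂ from-v)) (labelSum-walk⇒path w (walks w Ww) ru rv))))

    C₀ : G ks
    C₀ = labelSum (closed w₀ Ww₀)

    reach-closed : ∀ w → W w → Reach z z ℓ (C₀ ⊕ unitₜ (R w))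
    reach-closed w Ww = reach-cast refl (begin
      labelSum (closed w Ww)                               ≡⟨ labelSum-closed w Ww ⟩
      l-in ⊕ ((sumV u ⊕ sumVs w) ⊕ l-out)                  ≡⟨ cong (λ x → l-in ⊕ (x ⊕ l-out)) (label-shift w Ww) ⟩
      l-in ⊕ (((sumV u ⊕ sumVs w₀) ⊕ unitₜ (R w)) ⊕ l-out) ≡⟨ ⊕-pull-outʳ l-in (sumV u ⊕ sumVs w₀) l-out (unitₜ (R w)) ⟩
      (l-in ⊕ ((sumV u ⊕ sumVs w₀) ⊕ l-out)) ⊕ unitₜ (R w) ≡⟨ cong (_⊕ unitₜ (R w)) (labelSum-closed w₀ Ww₀) ⟨
      C₀ ⊕ unitₜ (R w)                                     ∎) (reach (closed w Ww))
      where
      open ≡-Reasoning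
      l-in l-out : G ks
      l-in = labelSum (proj₂ to-u)
      l-out = labelSum (proj₂ from-v)

    -- x rounds through w and k′ ∸ x rounds through w₀
    block : ∀ w → W w → ∀ x → x ≤ k′ → Reach z z (k′ * ℓ) (times k′ C₀ ⊕ unitₜ (x * R w))
    block w Ww x x≤k′ = reach-cast length≡ label≡
      (reach-++ (reach-times (reach-closed w Ww) x) (reach-times (reach (closed w₀ Ww₀)) (k′ ∸ x)))
      where
      open ≡-Reasoning
      length≡ : x * ℓ + (k′ ∸ x) * ℓ ≡ k′ * ℓ
      length≡ = trans (sym (*-distribʳ-+ ℓ x (k′ ∸ x))) (cong (_* ℓ) (m+[n∸m]≡n x≤k′))
      label≡ : times x (C₀ ⊕ unitₜ (R w)) ⊕ times (k′ ∸ x) C₀ ≡ times k′ C₀ ⊕ unitₜ (x * R w)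
      label≡ = begin
        times x (C₀ ⊕ unitₜ (R w)) ⊕ times (k′ ∸ x) C₀             ≡⟨ cong (_⊕ times (k′ ∸ x) C₀) (times-⊕ x C₀ (unitₜ (R w))) ⟩
        (times x C₀ ⊕ times x (unitₜ (R w))) ⊕ times (k′ ∸ x) C₀   ≡⟨ ⊕-right-comm (times x C₀) _ _ ⟩
        (times x C₀ ⊕ times (k′ ∸ x) C₀) ⊕ times x (unitₜ (R w))   ≡⟨ cong₂ _⊕_ (sym (times-+ x (k′ ∸ x) C₀)) (times-unit x t (R w)) ⟩
        times (x + (k′ ∸ x)) C₀ ⊕ unitₜ (x * R w)                  ≡⟨ cong (λ m → times m C₀ ⊕ unitₜ (x * R w)) (m+[n∸m]≡n x≤k′) ⟩
        times k′ C₀ ⊕ unitₜ (x * R w)                              ∎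

    M : ℕ
    M = #V ^ n

    interiors : Vec (V D) n HasCard M
    interiors = Vec-card V-card n

    candidate : Fin M → Vec (V D) n
    candidate = Inverse.to interiors

    shift-length : ℕ
    shift-length = sum {M} (λ _ → k′ * ℓ)

    shift-base : G ks
    shift-base = ⨁ M (λ _ → times k′ C₀)

    module Decided (decide : ∀ i → Dec (W (candidate i))) where

      pick : Fin M → Vec (V D) n
      pick i with decide i
      ... | yes _ = candidate i
      ... | no _ = w₀

      pick-W : ∀ i → W (pick i)
      pick-W i with decide i
      ... | yes Wi = Wi
      ... | no _ = Ww₀

      pick-from : ∀ w → W w → pick (Inverse.from interiors w) ≡ w
      pick-from w Ww with decide (Inverse.from interiors w)
      ... | yes _ = Inverse.strictlyInverseˡ interiors w
      ... | no ¬W = ⊥-elim (¬W (subst W (sym (Inverse.strictlyInverseˡ interiors w)) Ww))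

      open ModBezout (mod-bezout k′ (R ∘ pick)) renaming (divisor to g; coefficient to X; divisor∣ to g∣R∘pick)

      g∣R : ∀ w → W w → g ∣ R w
      g∣R w Ww = subst (λ w′ → g ∣ R w′) (pick-from w Ww) (g∣R∘pick (Inverse.from interiors w))

      g≡1 : g ≡ 1
      g≡1 = ∣1⇒≡1 (coprime (ℤ.+ g) λ w w′ Ww Ww′ → ∣-difference g (N w) (N w′) (k′ * N w₀) (g∣R w Ww) (g∣R w′ Ww′))

      reach-shift : ∀ y → Reach z z shift-length (shift-base ⊕ unitₜ y)
      reach-shift y = reach-cast refl label≡ (reach-⨁ M (λ _ → k′ * ℓ) _ λ i → block (pick i) (pick-W i) (xs i) (xs≤k′ i))
        where
        xs : Fin M → ℕ
        xs i = (y * X i) % suc k′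
        xs≤k′ : ∀ i → xs i ≤ k′
        xs≤k′ i = m<1+n⇒m≤n (m%n<n (y * X i) (suc k′))
        solved : sum (λ i → xs i * R (pick i)) % suc k′ ≡ y % suc k′
        solved = mod-bezout-solve k′ (R ∘ pick) X (trans combination (cong (_% suc k′) g≡1)) y
        label≡ : ⨁ M (λ i → times k′ C₀ ⊕ unitₜ (xs i * R (pick i))) ≡ shift-base ⊕ unitₜ y
        label≡ = trans (⨁-⊕ M (λ _ → times k′ C₀) (λ i → unitₜ (xs i * R (pick i))))
                       (cong (shift-base ⊕_) (trans (⨁-unit M t (λ i → xs i * R (pick i))) (unit-mod t _ y solved)))

    -- W is decided on the finitely many candidate interiors only under double negation
    reach-shift : ∀ y → Reach z z shift-length (shift-base ⊕ unitₜ y)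
    reach-shift y = ¬¬-decide-all M (W ∘ candidate) >>= λ decide → Decided.reach-shift decide y

  -- Doeblin's condition for the digraph

  module Mixing (strong : StronglyConnected D) (gcd-one : CycleGcdOne D) (condition₂ : ∀ t → Condition2 D t)
    (z : Recurrent) where

    open Aperiodicity strong gcd-one z using (round-trips; round-trip≤; closed-walks-of-length)

    unit-shifts : ∀ t → ∃ λ N → ∃ λ B → ∀ y → Reach z z N (B ⊕ unit t y)
    unit-shifts t with condition₂ t
    ... | n , u , v , W , ru , rv , walks , (w₀ , Ww₀) , (φ , fixed) , coprime = shift-length , shift-base , reach-shift
      where open UnitShifts strong z t ru rv walks w₀ Ww₀ φ fixed coprime

    every-label : ∃ λ N → ∀ h → Reach z z N h
    every-label = sum N , λ h → reach-cast refl (decompose h) (reach-⨁ r N _ λ t → proj₂ (proj₂ (unit-shifts t)) (coord (h ⊖ ⨁ r B) t))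
      where
      N : Fin r → ℕ
      N = proj₁ ∘ unit-shifts
      B : Fin r → G ks
      B = proj₁ ∘ proj₂ ∘ unit-shifts
      decompose : ∀ h → ⨁ r (λ t → B t ⊕ unit t (coord (h ⊖ ⨁ r B) t)) ≡ h
      decompose h = begin
        ⨁ r (λ t → B t ⊕ unit t (coord (h ⊖ ⨁ r B) t))   ≡⟨ ⨁-⊕ r B (λ t → unit t (coord (h ⊖ ⨁ r B) t)) ⟩
        ⨁ r B ⊕ ⨁ r (λ t → unit t (coord (h ⊖ ⨁ r B) t)) ≡⟨ cong (⨁ r B ⊕_) (⨁-units (h ⊖ ⨁ r B)) ⟩
        ⨁ r B ⊕ (h ⊖ ⨁ r B)                             ≡⟨ ⊕-⊖ (⨁ r B) h ⟩
        h                                               ∎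
        where open ≡-Reasoning

    -- a closed walk of the missing length is prepended and its label sum compensated
    every-long-closed : ∃ λ N → ∀ n → N ≤ n → ∀ h → Reach z z n h
    every-long-closed = N₁ + N₂ , λ n N≤n h →
      let p = closed (n ∸ N₂) (subst (_≤ n ∸ N₂) (m+n∸n≡m N₁ N₂) (∸-monoˡ-≤ N₂ N≤n)) in
      reach-cast (m∸n+n≡m (≤-trans (m≤n+m N₂ N₁) N≤n)) (⊕-⊖ (labelSum p) h) (reach-++ (reach p) (every (h ⊖ labelSum p)))
      where
      N₁ N₂ : ℕ
      N₁ = proj₁ closed-walks-of-length
      N₂ = proj₁ every-label
      closed : ∀ n → N₁ ≤ n → Path z z n
      closed = proj₂ closed-walks-of-length
      every : ∀ h → Reach z z N₂ h
      every = proj₂ every-label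

    doeblin : ∃ λ L → DoeblinAt (suc L) z
    doeblin = round-trips + N , reach⇒DoeblinAt L z λ x h →
      let a , p = connect strong x z
          a≤T = ≤-trans (m≤n+m a _) (round-trip≤ x)
      in reach-cast (m+[n∸m]≡n (≤-trans a≤T (≤-trans (m≤m+n round-trips N) (n≤1+n _)))) (⊕-⊖ (labelSum p) h)
           (reach-++ (reach p) (closed-reach (L ∸ a) (long-enough a≤T) (h ⊖ labelSum p)))
      where
      N L : ℕ
      N = proj₁ every-long-closed
      L = suc (round-trips + N)
      closed-reach : ∀ n → N ≤ n → ∀ h → Reach z z n h
      closed-reach = proj₂ every-long-closed
      long-enough : ∀ {a} → a ≤ round-trips → N ≤ L ∸ a
      long-enough {a} a≤T = subst (_≤ L ∸ a) (m+n∸m≡n round-trips N)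
        (≤-trans (∸-monoʳ-≤ (round-trips + N) a≤T) (∸-monoˡ-≤ a (n≤1+n _)))

  -- Asymptotics of the number of compositions

  ErrorBound : ℕ → G ks → ℕ → ℕ → ℕ → ℕ → Set
  ErrorBound H s p q C a = ∀ n → MComp D (suc a * σ + toℕ b) s HasCard n
    → ℤ.∣ ℤ.+ (n * order ks) ℤ.- ℤ.+ (H * J * K ^ a) ∣ * q ^ (suc a * σ + toℕ b) ≤ C * (H * J * K ^ a) * p ^ (suc a * σ + toℕ b)

  Asymptotic : ℕ → G ks → Set
  Asymptotic H s = ∃ λ p → ∃ λ q → ∃ λ C → 0 < p × p < q × ∀ a → ErrorBound H s p q C a

  module Asymptotics (L : ℕ) .{{_ : NonZero L}} (z : Recurrent) (doeblin : DoeblinAt L z)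
    {H} (start-degree : Σ (V D) (ArcS D) HasCard H) (s : G ks) where

    open Contraction L z doeblin using (ρ; |G|≤K^L)

    ρ<K^L : ρ < K ^ L
    ρ<K^L = ∸-monoʳ-< (0<order ks) |G|≤K^L

    instance
      _ : NonZero σ
      _ = Fin⇒NonZero b

    composition-count : Asymptotic H s
    composition-count with exponential-bound L σ K ρ ρ<K^L
    ... | p , q , C , 0<p , p<q , decay = p , q , order ks * C , 0<p , p<q , λ a →
          subst (ErrorBound H s p q (order ks * C)) (sym (a≡ a)) (bound (a / L) (a % L) (m%n<n a L))
      where
      a≡ : ∀ a → a ≡ a / L * L + a % L
      a≡ a = trans (m≡m%n+[m/n]*n a L) (+-comm (a % L) _)
      bound : ∀ j r₀ → r₀ < L → ErrorBound H s p q (order ks * C) (j * L + r₀)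
      bound j r₀ r₀<L n n-card = begin
        ℤ.∣ ℤ.+ (n * order ks) ℤ.- ℤ.+ (H * J * K ^ a) ∣ * q ^ m
          ≤⟨ *-monoˡ-≤ (q ^ m) (Within⇒∣-∣≤ (MComp-within L z doeblin j r₀ s start-degree n n-card)) ⟩
        H * (order ks * (ρ ^ j * (K ^ r₀ * J))) * q ^ m
          ≡⟨ cong (λ e → H * e * q ^ m) (error-regroup (order ks) (ρ ^ j) (K ^ r₀) J) ⟩
        H * (J * order ks * (ρ ^ j * K ^ r₀)) * q ^ m
          ≡⟨ error-factor H J (order ks) (ρ ^ j * K ^ r₀) (q ^ m) ⟩
        H * J * order ks * (ρ ^ j * K ^ r₀ * q ^ m)
          ≤⟨ *-monoʳ-≤ (H * J * order ks) (decay j r₀ (toℕ b) r₀<L (toℕ<n b)) ⟩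
        H * J * order ks * (C * K ^ a * p ^ m)
          ≡⟨ main-factor (H * J) (order ks) C (K ^ a) (p ^ m) ⟩
        order ks * C * (H * J * K ^ a) * p ^ m
          ∎
        where
        open ≤-Reasoning
        a m : ℕ
        a = j * L + r₀
        m = suc a * σ + toℕ b

  count-asymptotics : StronglyConnected D → CycleGcdOne D → (∀ t → Condition2 D t) → (z : Recurrent)
    → ∀ {H} → Σ (V D) (ArcS D) HasCard H → (s : G ks) → Asymptotic H s
  count-asymptotics strong gcd-one condition₂ z {H} start-degree s = from-doeblin (Mixing.doeblin strong gcd-one condition₂ z)
    where
    -- a with-abstraction here makes Agda unfold the (huge) length L; matching on the pair does not
    from-doeblin : (∃ λ L → DoeblinAt (suc L) z) → Asymptotic H s
    from-doeblin (L , doeblin) = Asymptotics.composition-count (suc L) z doeblin start-degree s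

-- imported only here: the integer +_ would make sections such as (c +_) ambiguous
open import Data.Integer using (+_)
open import Data.Product using (∃-syntax)

corollary1 : ∀ {r} (ks : Vec ℕ r) (σ : ℕ) (D : LRDigraph ks σ)
    → Σ (V D) (ArcS D)
    → Σ (V D) (λ u → Σ (Fin σ) λ j → Σ (Vec (G ks) (toℕ j)) λ y → ArcRT D u j y)
    → StronglyConnected D
    → AtLeastTwoRec D
    → CycleGcdOne D
    → (∀ t → Condition2 D t)
    → (b : Fin σ)
    → Σ (V D) (λ u → Σ (Vec (G ks) (toℕ b)) λ y → ArcRT D u b y)
    → (H J K : ℕ)
    → Σ (V D) (ArcS D) HasCard H
    → (∀ u → Rec D u → Σ (V D) (ArcRR D u) HasCard K)
    → (∀ u → Rec D u → Σ (Vec (G ks) (toℕ b)) (ArcRT D u b) HasCard J)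
    → (s : G ks)
    → ∃[ p ] ∃[ q ] ∃[ C ] ∃[ M ]
        (0 < p × p < q
        × (∀ a → 1 ≤ a → M ≤ a → ∀ n → MComp D (a * σ + toℕ b) s HasCard n
             → ℤ.∣ (+ (n * order ks)) ℤ.- (+ (H * J * K ^ (a ∸ 1))) ∣ * q ^ (a * σ + toℕ b)
               ≤ C * (H * J * K ^ (a ∸ 1)) * p ^ (a * σ + toℕ b)))
corollary1 ks σ D (z , rz , _) _ strong _ gcd-one condition₂ b _ H J K start-degree out-degree end-degree s =
  let p , q , C , 0<p , p<q , bound =
        Compositions.count-asymptotics D b out-degree end-degree strong gcd-one condition₂ (z , rz) start-degree s
  in p , q , C , 1 , 0<p , p<q , λ { (suc a) _ _ → bound a }
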